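{- Let $m,n$ be positive integers with $m-2\ge n\ge1$ and let $\beta$ be the larger root of $x^2-mx+n$. A digit string $x_kx_{k-1}x_{k-2}\cdots$ (digits $x_i\in\mathbb{Z}$, indexed by decreasing integers) with only finitely many non-zero digits is admissible as a $(-\beta)$-expansion if and only if $x_i\in\{0,1,\dots,m-1\}$ for all $i$ and, for every $i$, $x_i=m-1$ implies $x_{i-1}\ge n$.
   Context: For $\beta>1$, let $I_\beta=\big[\frac{ -\beta}{\beta+1},\frac1{\beta+1}\big)$ and $T_{ -\beta}:I_\beta\to I_\beta$, $T_{ -\beta}(x)=-\beta x-\lfloor -\beta x+\frac{\beta}{\beta+1}\rfloor$. For $y\in I_\beta$ put $y_i=\lfloor -\beta T_{ -\beta}^{i-1}(y)+\frac{\beta}{\beta+1}\rfloor$ ($i\ge1$) and $d_{ -\beta}(y)=y_1y_2y_3\cdots$. The $(-\beta)$-expansion of a real $x$: take the minimal non-negative integer $j$ with $y=x(-\beta)^{ -j}\in\big(\frac{ -\beta}{\beta+1},\frac1{\beta+1}\big)$, compute $d_{ -\beta}(y)=y_1y_2\cdots$; the expansion is $x=\sum_{i\ge1}y_i(-\beta)^{j-i}$ with digit $y_i$ the coefficient of $(-\beta)^{j-i}$. A digit string $x_kx_{k-1}\cdots$ (digit $x_i$ at position $(-\beta)^i$) is called admissible as a $(-\beta)$-expansion if it is, up to leading zeros, the digit string of the $(-\beta)$-expansion of the real number $\sum_i x_i(-\beta)^i$. -}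

module Defs where

open import Data.Nat as ℕ using (ℕ; zero; suc)
open import Data.Integer as ℤ using (ℤ; +_; -[1+_])
open import Data.Rational as ℚ using (ℚ; 0ℚ; 1ℚ)
open import Data.Rational.Properties as ℚP using ()
open import Data.Product using (Σ; _×_; _,_; proj₁; proj₂)
open import Data.Sum using (_⊎_)
open import Relation.Nullary using (¬_; yes; no)
open import Relation.Binary.PropositionalEquality using (_≡_)

-- Exact real arithmetic in ℚ(β), β the larger root of x² - m x + n.
-- An element (a , b) : K denotes the REAL number a + b·β.
-- All real numbers occurring in the statement (digit-string values,
-- β/(β+1), 1/(β+1), (-β)^{±1}, and the whole T_{-β}-orbit) lie in ℚ(β).

K : Set
K = ℚ × ℚ

-- total inverse on ℚ (value at 0 is irrelevant, never used there)
qinv : ℚ → ℚ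
qinv q with q ℚP.≟ 0ℚ
... | yes _ = 0ℚ
... | no q≢0 = ℚ.1/_ q {{ℚ.≢-nonZero q≢0}}

module Field (m n : ℕ) where

  mq nq : ℚ
  mq = (+ m ℚ./ 1)
  nq = (+ n ℚ./ 1)

  -- discriminant D = m² - 4n, so β = (m + √D)/2
  Dq : ℚ
  Dq = ℚ._-_ (ℚ._*_ mq mq) (ℚ._*_ ((+ 4 ℚ./ 1)) nq)

  ι : ℤ → K
  ι k = (k ℚ./ 1) , 0ℚ

  β : K
  β = 0ℚ , 1ℚ

  _⊕_ : K → K → K
  (a , b) ⊕ (c , d) = ℚ._+_ a c , ℚ._+_ b d

  ⊖_ : K → K
  ⊖ (a , b) = ℚ.-_ a , ℚ.-_ b

  _⊝_ : K → K → K
  x ⊝ y = x ⊕ (⊖ y)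

  -- (a + bβ)(c + dβ) = ac - n bd + (ad + bc + m bd) β   using β² = mβ - n
  _⊛_ : K → K → K
  (a , b) ⊛ (c , d) =
    ℚ._-_ (ℚ._*_ a c) (ℚ._*_ nq (ℚ._*_ b d)) ,
    ℚ._+_ (ℚ._+_ (ℚ._*_ a d) (ℚ._*_ b c)) (ℚ._*_ mq (ℚ._*_ b d))

  -- conjugate a + b β' with β' = m - β, and norm (a+bβ)(a+bβ')
  conj : K → K
  conj (a , b) = ℚ._+_ a (ℚ._*_ b mq) , ℚ.-_ b

  norm : K → ℚ
  norm (a , b) = ℚ._+_ (ℚ._+_ (ℚ._*_ a a) (ℚ._*_ (ℚ._*_ a b) mq)) (ℚ._*_ (ℚ._*_ b b) nq)

  -- multiplicative inverse (valid whenever the norm is non-zero,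
  -- which is the case for β and β+1 when n ≥ 1)
  inv : K → K
  inv x with conj x
  ... | (c , d) = ℚ._*_ c (qinv (norm x)) , ℚ._*_ d (qinv (norm x))

  -- positivity of the real number a + bβ = ((2a + bm) + b√D)/2 :
  -- P + Q√D > 0 with P = 2a + bm, Q = b, D > 0.
  PosPQ : ℚ → ℚ → Set
  PosPQ P Q =
      (ℚ._≤_ 0ℚ P × ℚ._≤_ 0ℚ Q × (ℚ._<_ 0ℚ P ⊎ ℚ._<_ 0ℚ Q))
    ⊎ ((ℚ._<_ 0ℚ P × ℚ._<_ Q 0ℚ) × ℚ._<_ (ℚ._*_ (ℚ._*_ Q Q) Dq) (ℚ._*_ P P))
    ⊎ ((ℚ._<_ P 0ℚ × ℚ._<_ 0ℚ Q) × ℚ._<_ (ℚ._*_ P P) (ℚ._*_ (ℚ._*_ Q Q) Dq))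

  Pos : K → Set
  Pos (a , b) = PosPQ (ℚ._+_ (ℚ._+_ a a) (ℚ._*_ b mq)) b

  _≺_ : K → K → Set
  x ≺ y = Pos (y ⊝ x)

  _≼_ : K → K → Set
  x ≼ y = ¬ (y ≺ x)

  _≈_ : K → K → Set
  x ≈ y = (x ≼ y) × (y ≼ x)

  pow : K → ℕ → K
  pow x zero = ι (+ 1)
  pow x (suc k) = x ⊛ pow x k

  -βK : K
  -βK = ⊖ β

  negβ^ : ℤ → K
  negβ^ (+ k) = pow -βK k
  negβ^ -[1+ k ] = pow (inv -βK) (suc k)

  c : K
  c = β ⊛ inv (β ⊕ ι (+ 1))

  OpenI : K → Set
  OpenI y = ((⊖ c) ≺ y) × (y ≺ inv (β ⊕ ι (+ 1)))

  IsFloor : K → ℤ → Set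
  IsFloor z k = (ι k ≼ z) × (z ≺ ι (ℤ._+_ k (+ 1)))

  -- value Σ_{i=-N}^{N} x_i (-β)^i, summing k = 0 .. 2N with i = k - N
  valueAux : (ℤ → ℤ) → ℕ → ℕ → K
  valueAux x N zero = ι (+ 0)
  valueAux x N (suc k) =
    valueAux x N k ⊕ (ι (x (ℤ._-_ (+ k) (+ N))) ⊛ negβ^ (ℤ._-_ (+ k) (+ N)))

  value : (ℤ → ℤ) → ℕ → K
  value x N = valueAux x N (suc (ℕ._+_ N N))

  -- digit at position p of the expansion with exponent j and digit
  -- sequence d (d i = y_{i+1}, the coefficient of (-β)^{j-1-i});
  -- positions p ≥ j carry digit 0.
  digitAt : ℕ → (ℕ → ℤ) → ℤ → ℤ
  digitAt j d p with ℤ._-_ (ℤ._-_ (+ j) (+ 1)) p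
  ... | + i = d i
  ... | -[1+ _ ] = + 0

  IsExpansion : K → (ℤ → ℤ) → Set
  IsExpansion v e =
    Σ ℕ λ j →
      (∀ j' → ℕ._<_ j' j → ¬ OpenI (v ⊛ pow (inv -βK) j')) ×
      OpenI (v ⊛ pow (inv -βK) j) ×
      Σ (ℕ → K) λ t → Σ (ℕ → ℤ) λ d →
        (t 0 ≈ (v ⊛ pow (inv -βK) j)) ×
        (∀ i → IsFloor ((-βK ⊛ t i) ⊕ c) (d i)) ×
        (∀ i → t (suc i) ≈ ((-βK ⊛ t i) ⊝ ι (d i))) ×
        (∀ p → e p ≡ digitAt j d p)

SupportedIn : (ℤ → ℤ) → ℕ → Set
SupportedIn x N = ∀ i → ℕ._<_ N (ℤ.∣ i ∣) → x i ≡ + 0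

Admissible : (m n : ℕ) → (ℤ → ℤ) → ℕ → Set
Admissible m n x N = Field.IsExpansion m n (Field.value m n x N) x

module Submission where

-- Numbers of ℚ(β) are handled exactly as pairs of rationals: since the discriminant m² - 4n is
-- not a square, the sign of a + bβ is decided by comparing squares, so the order of ℚ(β) is exact.
-- Necessity: the orbit of T₋β stays in I_β = [l, r), so each digit ⌊-β t + β/(β+1)⌋ lies in
-- {0, …, m-1}, and after a digit m - 1 the next point exceeds n.
-- Sufficiency: the tails .x₍ₖ₋₁₎ … x₍₋N₎ of the digit string stay in (l, r), and below a bound B
-- whenever their leading digit is at least n, which is exactly what a preceding digit m - 1 needs;
-- so the orbit of the value runs through these tails and reads the digits back. The exponent j is
-- one past the leading nonzero digit, since powers of -β never bring a number above r into I_β.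

open import Defs
open import Data.Nat as ℕ using (ℕ; zero; suc; _≤_; _+_; _∸_)
import Data.Nat.Properties as ℕP
import Data.Nat.Tactic.RingSolver as ℕ-Solver
import Data.Nat.Coprimality as Coprime
open import Data.Nat.Divisibility using (_∣_; divides; ∣-refl)
open import Data.Integer as ℤ using (ℤ; +_; -[1+_])
import Data.Integer.Properties as ℤP
import Data.Integer.Tactic.RingSolver as ℤ-Solver
open import Data.Rational as ℚ using (ℚ; 0ℚ; 1ℚ; mkℚ)
import Data.Rational.Properties as ℚP
import Data.Rational.Unnormalised as ℚᵘ
import Data.Rational.Unnormalised.Properties as ℚᵘP
open import Data.Rational.Solver using (module +-*-Solver)
open +-*-Solver using (solve; _:+_; _:*_; _:-_; :-_; _:=_; con)
open import Data.Maybe using (Maybe; just; nothing)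
open import Data.Product using (Σ; _×_; _,_; proj₁; proj₂)
open import Data.Sum using (_⊎_; inj₁; inj₂; [_,_]′)
open import Data.Empty using (⊥; ⊥-elim)
open import Relation.Nullary using (¬_; yes; no)
open import Relation.Nullary.Decidable using (decidable-stable; toSum)
open import Relation.Binary.PropositionalEquality hiding (J)
open import Relation.Binary.Definitions using (tri<; tri≈; tri>)
open import Algebra.Bundles using (CommutativeRing)
open import Algebra.Solver.Ring.AlmostCommutativeRing using (_-Raw-AlmostCommutative⟶_)
import Algebra.Solver.Ring as RingSolver
import Algebra.Solver.Ring.AlmostCommutativeRing as ACR
open import Function.Bundles using (_⇔_; mk⇔)

fromℤ : ℤ → ℚ
fromℤ k = k ℚ./ 1

coprime-1 : ∀ k → Coprime.Coprime (ℤ.∣ k ∣) 1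
coprime-1 k = Coprime.sym (Coprime.1-coprimeTo _)

fromℤ≡mkℚ : ∀ k → fromℤ k ≡ mkℚ k 0 (coprime-1 k)
fromℤ≡mkℚ (+ n) = ℚP.normalize-coprime (coprime-1 (+ n))
fromℤ≡mkℚ -[1+ n ] = cong ℚ.-_ (ℚP.normalize-coprime (coprime-1 (+ suc n)))

toℚᵘ-fromℤ : ∀ k → ℚ.toℚᵘ (fromℤ k) ℚᵘ.≃ ℚᵘ.mkℚᵘ k 0
toℚᵘ-fromℤ k = ℚP.toℚᵘ-fromℚᵘ (ℚᵘ.mkℚᵘ k 0)

fromℤ-+ : ∀ a b → fromℤ (a ℤ.+ b) ≡ fromℤ a ℚ.+ fromℤ b
fromℤ-+ a b = ℚP.toℚᵘ-injective (ℚᵘP.≃-trans (toℚᵘ-fromℤ (a ℤ.+ b)) (ℚᵘP.≃-trans mid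
   (ℚᵘP.≃-sym (ℚᵘP.≃-trans (ℚP.toℚᵘ-homo-+ (fromℤ a) (fromℤ b)) (ℚᵘP.+-cong (toℚᵘ-fromℤ a) (toℚᵘ-fromℤ b))))))
  where
  cross : ∀ a b → (a ℤ.+ b) ℤ.* + 1 ≡ (a ℤ.* + 1 ℤ.+ b ℤ.* + 1) ℤ.* + 1
  cross = ℤ-Solver.solve-∀
  mid : ℚᵘ.mkℚᵘ (a ℤ.+ b) 0 ℚᵘ.≃ (ℚᵘ.mkℚᵘ a 0 ℚᵘ.+ ℚᵘ.mkℚᵘ b 0)
  mid = ℚᵘ.*≡* (cross a b)

fromℤ-* : ∀ a b → fromℤ (a ℤ.* b) ≡ fromℤ a ℚ.* fromℤ b
fromℤ-* a b = ℚP.toℚᵘ-injective (ℚᵘP.≃-trans (toℚᵘ-fromℤ (a ℤ.* b)) (ℚᵘP.≃-trans (ℚᵘ.*≡* refl)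
   (ℚᵘP.≃-sym (ℚᵘP.≃-trans (ℚP.toℚᵘ-homo-* (fromℤ a) (fromℤ b)) (ℚᵘP.*-cong (toℚᵘ-fromℤ a) (toℚᵘ-fromℤ b))))))

fromℤ-neg : ∀ a → fromℤ (ℤ.- a) ≡ ℚ.- fromℤ a
fromℤ-neg a = ℚP.toℚᵘ-injective (ℚᵘP.≃-trans (toℚᵘ-fromℤ (ℤ.- a)) (ℚᵘP.≃-sym
   (ℚᵘP.≃-trans (ℚP.toℚᵘ-homo‿- (fromℤ a)) (ℚᵘP.-‿cong (toℚᵘ-fromℤ a)))))

fromℤ-mono-< : ∀ {a b} → a ℤ.< b → fromℤ a ℚ.< fromℤ b
fromℤ-mono-< {a} {b} a<b rewrite fromℤ≡mkℚ a | fromℤ≡mkℚ b =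
  ℚ.*<* (subst₂ ℤ._<_ (sym (ℤP.*-identityʳ a)) (sym (ℤP.*-identityʳ b)) a<b)

fromℤ-mono-≤ : ∀ {a b} → a ℤ.≤ b → fromℤ a ℚ.≤ fromℤ b
fromℤ-mono-≤ {a} {b} a≤b rewrite fromℤ≡mkℚ a | fromℤ≡mkℚ b =
  ℚ.*≤* (subst₂ ℤ._≤_ (sym (ℤP.*-identityʳ a)) (sym (ℤP.*-identityʳ b)) a≤b)

0<_ 0≤_ : ℚ → Set
0< x = 0ℚ ℚ.< x
0≤ x = 0ℚ ℚ.≤ x

0<⇒0≤ : ∀ {x} → 0< x → 0≤ x
0<⇒0≤ = ℚP.<⇒≤

0≮0 : ¬ 0< 0ℚ
0≮0 = ℚP.<-irrefl refl

0<-≡ : ∀ {a b} → 0< a → a ≡ b → 0< b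
0<-≡ h refl = h

0≤-≡ : ∀ {a b} → 0≤ a → a ≡ b → 0≤ b
0≤-≡ h refl = h

0<-+ : ∀ {a b} → 0< a → 0< b → 0< (a ℚ.+ b)
0<-+ = ℚP.+-mono-<

0≤-+ : ∀ {a b} → 0≤ a → 0≤ b → 0≤ (a ℚ.+ b)
0≤-+ = ℚP.+-mono-≤

0<-+0≤ : ∀ {a b} → 0< a → 0≤ b → 0< (a ℚ.+ b)
0<-+0≤ = ℚP.+-mono-<-≤

0≤-+0< : ∀ {a b} → 0≤ a → 0< b → 0< (a ℚ.+ b)
0≤-+0< = ℚP.+-mono-≤-<

0<-* : ∀ {a b} → 0< a → 0< b → 0< (a ℚ.* b)
0<-* {a} {b} ha hb = ℚP.positive⁻¹ _ {{ℚP.pos*pos⇒pos a {{ℚ.positive ha}} b {{ℚ.positive hb}}}}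

0≤-* : ∀ {a b} → 0≤ a → 0≤ b → 0≤ (a ℚ.* b)
0≤-* {a} {b} ha hb = ℚP.nonNegative⁻¹ _ {{ℚP.nonNeg*nonNeg⇒nonNeg a {{ℚ.nonNegative ha}} b {{ℚ.nonNegative hb}}}}

<⇒0<-diff : ∀ {a b} → a ℚ.< b → 0< (b ℚ.- a)
<⇒0<-diff {a} {b} h = subst (ℚ._< (b ℚ.- a)) (ℚP.+-inverseʳ a) (ℚP.+-monoˡ-< (ℚ.- a) h)

≤⇒0≤-diff : ∀ {a b} → a ℚ.≤ b → 0≤ (b ℚ.- a)
≤⇒0≤-diff {a} {b} h = subst (ℚ._≤ (b ℚ.- a)) (ℚP.+-inverseʳ a) (ℚP.+-monoˡ-≤ (ℚ.- a) h)

0<-diff⇒< : ∀ {a b} → 0< (b ℚ.- a) → a ℚ.< b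
0<-diff⇒< {a} {b} h = subst₂ ℚ._<_ (ℚP.+-identityˡ a) (cancel a b) (ℚP.+-monoˡ-< a h)
  where
  cancel : ∀ a b → (b ℚ.- a) ℚ.+ a ≡ b
  cancel = solve 2 (λ a b → (b :- a) :+ a := b) refl

neg-involutive : ∀ x → ℚ.- (ℚ.- x) ≡ x
neg-involutive = solve 1 (λ x → :- (:- x) := x) refl

neg-square : ∀ a → (ℚ.- a) ℚ.* (ℚ.- a) ≡ a ℚ.* a
neg-square = solve 1 (λ a → (:- a) :* (:- a) := a :* a) refl

0<⊎0≤-neg : ∀ x → 0< x ⊎ 0≤ (ℚ.- x)
0<⊎0≤-neg x with ℚP.<-cmp 0ℚ x
... | tri< a _ _ = inj₁ a
... | tri≈ _ b _ = inj₂ (ℚP.≤-reflexive (cong ℚ.-_ b))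
... | tri> _ _ c = inj₂ (ℚP.neg-antimono-≤ (ℚP.<⇒≤ c))

0≤⊎<0 : ∀ x → 0≤ x ⊎ x ℚ.< 0ℚ
0≤⊎<0 x with ℚP.<-cmp x 0ℚ
... | tri< a _ _ = inj₂ a
... | tri≈ _ b _ = inj₁ (ℚP.≤-reflexive (sym b))
... | tri> _ _ c = inj₁ (ℚP.<⇒≤ c)

0<-trichotomy : ∀ x → 0< x ⊎ (x ≡ 0ℚ) ⊎ 0< (ℚ.- x)
0<-trichotomy x with ℚP.<-cmp 0ℚ x
... | tri< a _ _ = inj₁ a
... | tri≈ _ b _ = inj₂ (inj₁ (sym b))
... | tri> _ _ c = inj₂ (inj₂ (ℚP.neg-antimono-< c))

0<∧0≤-neg⇒⊥ : ∀ {x} → 0< x → 0≤ (ℚ.- x) → ⊥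
0<∧0≤-neg⇒⊥ {x} p n = ℚP.<-irrefl refl (ℚP.<-≤-trans p (subst (ℚ._≤ 0ℚ) (neg-involutive x) (ℚP.neg-antimono-≤ n)))

0<∧0<-neg⇒⊥ : ∀ {x} → 0< x → 0< (ℚ.- x) → ⊥
0<∧0<-neg⇒⊥ p q = 0<∧0≤-neg⇒⊥ p (0<⇒0≤ q)

0≤∧0<-neg⇒⊥ : ∀ {x} → 0≤ x → 0< (ℚ.- x) → ⊥
0≤∧0<-neg⇒⊥ {x} n p = 0<∧0≤-neg⇒⊥ p (0≤-≡ n (sym (neg-involutive x)))

0≤-square : ∀ a → 0≤ (a ℚ.* a)
0≤-square a with 0<⊎0≤-neg a
... | inj₁ p = 0≤-* (0<⇒0≤ p) (0<⇒0≤ p)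
... | inj₂ n = 0≤-≡ (0≤-* n n) (neg-square a)

square≡0⇒≡0 : ∀ a → a ℚ.* a ≡ 0ℚ → a ≡ 0ℚ
square≡0⇒≡0 a h with 0<-trichotomy a
... | inj₂ (inj₁ a≡0) = a≡0
... | inj₁ p = ⊥-elim (0≮0 (0<-≡ (0<-* p p) h))
... | inj₂ (inj₂ n) = ⊥-elim (0≮0 (0<-≡ (0<-* n n) (trans (neg-square a) h)))

0<-cancelˡ-* : ∀ {l x} → 0< l → 0< (l ℚ.* x) → 0< x
0<-cancelˡ-* {l} {x} pl h with 0<⊎0≤-neg x
... | inj₁ p = p
... | inj₂ n = ⊥-elim (0<∧0≤-neg⇒⊥ h (0≤-≡ (0≤-* (0<⇒0≤ pl) n) (e l x)))
  where
  e : ∀ l x → l ℚ.* (ℚ.- x) ≡ ℚ.- (l ℚ.* x)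
  e = solve 2 (λ l x → l :* (:- x) := :- (l :* x)) refl

0<-*-mono-diff : ∀ {a b c d} → 0≤ a → 0< (b ℚ.- a) → 0≤ c → 0< (d ℚ.- c) → 0< (b ℚ.* d ℚ.- a ℚ.* c)
0<-*-mono-diff {a} {b} {c} {d} na pba nc pdc =
  0<-≡ (0<-+0≤ (0<-* pba (0<-+0≤ pdc nc)) (0≤-* na (0<⇒0≤ pdc))) (e a b c d)
  where
  e : ∀ a b c d → (b ℚ.- a) ℚ.* ((d ℚ.- c) ℚ.+ c) ℚ.+ a ℚ.* (d ℚ.- c) ≡ b ℚ.* d ℚ.- a ℚ.* c
  e = solve 4 (λ a b c d → (b :- a) :* ((d :- c) :+ c) :+ a :* (d :- c) := b :* d :- a :* c) refl

squares⇒0<-diff : ∀ {a b} → 0< (b ℚ.* b ℚ.- a ℚ.* a) → 0< b → 0< (b ℚ.- a)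
squares⇒0<-diff {a} {b} h pb with 0<⊎0≤-neg (b ℚ.- a)
... | inj₁ p = p
... | inj₂ n = ⊥-elim (0<∧0≤-neg⇒⊥ h (0≤-≡ (0≤-* n (0<⇒0≤ (0≤-+0< n (0<-+ pb pb)))) (e a b)))
  where
  e : ∀ a b → (ℚ.- (b ℚ.- a)) ℚ.* ((ℚ.- (b ℚ.- a)) ℚ.+ (b ℚ.+ b)) ≡ ℚ.- (b ℚ.* b ℚ.- a ℚ.* a)
  e = solve 2 (λ a b → (:- (b :- a)) :* ((:- (b :- a)) :+ (b :+ b)) := :- (b :* b :- a :* a)) refl

squares⇒0<-sum : ∀ {a b} → 0< (b ℚ.* b ℚ.- a ℚ.* a) → 0< b → 0< (b ℚ.+ a)
squares⇒0<-sum {a} {b} h pb = 0<-≡ (squares⇒0<-diff {ℚ.- a} {b} (0<-≡ h (e1 a b)) pb) (e2 a b)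
  where
  e1 : ∀ a b → b ℚ.* b ℚ.- a ℚ.* a ≡ b ℚ.* b ℚ.- (ℚ.- a) ℚ.* (ℚ.- a)
  e1 = solve 2 (λ a b → b :* b :- a :* a := b :* b :- (:- a) :* (:- a)) refl
  e2 : ∀ a b → b ℚ.- ℚ.- a ≡ b ℚ.+ a
  e2 = solve 2 (λ a b → b :- (:- a) := b :+ a) refl

module SqrtOrder (D : ℚ) (0<D : 0< D) (D-nonsquare : ∀ P Q → P ℚ.* P ≡ (Q ℚ.* Q) ℚ.* D → Q ≡ 0ℚ) where

  -- P + Q√D > 0; for D = Field.Dq m n this is Field.PosPQ m n.
  PosPQ : ℚ → ℚ → Set
  PosPQ P Q =
      (ℚ._≤_ 0ℚ P × ℚ._≤_ 0ℚ Q × (ℚ._<_ 0ℚ P ⊎ ℚ._<_ 0ℚ Q))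
    ⊎ ((ℚ._<_ 0ℚ P × ℚ._<_ Q 0ℚ) × ℚ._<_ (ℚ._*_ (ℚ._*_ Q Q) D) (ℚ._*_ P P))
    ⊎ ((ℚ._<_ P 0ℚ × ℚ._<_ 0ℚ Q) × ℚ._<_ (ℚ._*_ P P) (ℚ._*_ (ℚ._*_ Q Q) D))

  norm⁺ : ℚ → ℚ → ℚ
  norm⁺ P Q = P ℚ.* P ℚ.- (Q ℚ.* Q) ℚ.* D

  norm⁻ : ℚ → ℚ → ℚ
  norm⁻ P Q = (Q ℚ.* Q) ℚ.* D ℚ.- P ℚ.* P

  PDominates QDominates : ℚ → ℚ → Set
  PDominates P Q = 0< P × 0< (norm⁺ P Q)
  QDominates P Q = 0< Q × 0< (norm⁻ P Q)

  norm⁻≡-norm⁺ : ∀ P Q → norm⁻ P Q ≡ ℚ.- norm⁺ P Q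
  norm⁻≡-norm⁺ P Q = e P Q D
    where
    e : ∀ P Q D → (Q ℚ.* Q) ℚ.* D ℚ.- P ℚ.* P ≡ ℚ.- (P ℚ.* P ℚ.- (Q ℚ.* Q) ℚ.* D)
    e = solve 3 (λ P Q D → (Q :* Q) :* D :- P :* P := :- (P :* P :- (Q :* Q) :* D)) refl

  0≤-Q²D : ∀ Q → 0≤ ((Q ℚ.* Q) ℚ.* D)
  0≤-Q²D Q = 0≤-* (0≤-square Q) (0<⇒0≤ 0<D)

  norm⁺≡0⇒zero : ∀ P Q → norm⁺ P Q ≡ 0ℚ → (P ≡ 0ℚ) × (Q ≡ 0ℚ)
  norm⁺≡0⇒zero P Q h = square≡0⇒≡0 P (trans e2 (trans (cong (λ q → (q ℚ.* q) ℚ.* D) q0) (e3 D))) , q0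
    where
    e : ∀ P Q D → P ℚ.* P ≡ (P ℚ.* P ℚ.- (Q ℚ.* Q) ℚ.* D) ℚ.+ (Q ℚ.* Q) ℚ.* D
    e = solve 3 (λ P Q D → P :* P := (P :* P :- (Q :* Q) :* D) :+ (Q :* Q) :* D) refl
    e2 : P ℚ.* P ≡ (Q ℚ.* Q) ℚ.* D
    e2 = trans (e P Q D) (trans (cong (ℚ._+ ((Q ℚ.* Q) ℚ.* D)) h) (ℚP.+-identityˡ _))
    q0 = D-nonsquare P Q e2
    e3 : ∀ D → (0ℚ ℚ.* 0ℚ) ℚ.* D ≡ 0ℚ
    e3 = solve 1 (λ D → (con 0ℚ :* con 0ℚ) :* D := con 0ℚ) refl

  P≡0⇒¬0<norm⁺ : ∀ P Q → P ≡ 0ℚ → ¬ 0< (norm⁺ P Q)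
  P≡0⇒¬0<norm⁺ P Q refl h = 0≤∧0<-neg⇒⊥ (0≤-Q²D Q) (0<-≡ h (e Q D))
    where
    e : ∀ Q D → 0ℚ ℚ.* 0ℚ ℚ.- (Q ℚ.* Q) ℚ.* D ≡ ℚ.- ((Q ℚ.* Q) ℚ.* D)
    e = solve 2 (λ Q D → con 0ℚ :* con 0ℚ :- (Q :* Q) :* D := :- ((Q :* Q) :* D)) refl

  Q≡0⇒¬0<norm⁻ : ∀ P Q → Q ≡ 0ℚ → ¬ 0< (norm⁻ P Q)
  Q≡0⇒¬0<norm⁻ P Q refl h = 0≤∧0<-neg⇒⊥ (0≤-square P) (0<-≡ h (e P D))
    where
    e : ∀ P D → (0ℚ ℚ.* 0ℚ) ℚ.* D ℚ.- P ℚ.* P ≡ ℚ.- (P ℚ.* P)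
    e = solve 2 (λ P D → (con 0ℚ :* con 0ℚ) :* D :- P :* P := :- (P :* P)) refl

  dominates : ∀ {P Q} → PosPQ P Q → PDominates P Q ⊎ QDominates P Q
  dominates {P} {Q} (inj₁ (nP , nQ , pp)) with 0<-trichotomy (norm⁺ P Q)
  ... | inj₁ pN with 0<-trichotomy P
  ...   | inj₁ pP = inj₁ (pP , pN)
  ...   | inj₂ (inj₁ z) = ⊥-elim (P≡0⇒¬0<norm⁺ P Q z pN)
  ...   | inj₂ (inj₂ q) = ⊥-elim (0≤∧0<-neg⇒⊥ nP q)
  dominates {P} {Q} (inj₁ (nP , nQ , inj₁ a)) | inj₂ (inj₁ z) = ⊥-elim (0≮0 (subst 0<_ (proj₁ (norm⁺≡0⇒zero P Q z)) a))
  dominates {P} {Q} (inj₁ (nP , nQ , inj₂ a)) | inj₂ (inj₁ z) = ⊥-elim (0≮0 (subst 0<_ (proj₂ (norm⁺≡0⇒zero P Q z)) a))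
  dominates {P} {Q} (inj₁ (nP , nQ , pp)) | inj₂ (inj₂ pN') with 0<-trichotomy Q
  ... | inj₁ pQ = inj₂ (pQ , 0<-≡ pN' (sym (norm⁻≡-norm⁺ P Q)))
  ... | inj₂ (inj₁ z) = ⊥-elim (Q≡0⇒¬0<norm⁻ P Q z (0<-≡ pN' (sym (norm⁻≡-norm⁺ P Q))))
  ... | inj₂ (inj₂ q) = ⊥-elim (0≤∧0<-neg⇒⊥ nQ q)
  dominates {P} {Q} (inj₂ (inj₁ ((pP , _) , lt))) = inj₁ (pP , <⇒0<-diff lt)
  dominates {P} {Q} (inj₂ (inj₂ ((_ , pQ) , lt))) = inj₂ (pQ , <⇒0<-diff lt)

  PDominates⇒PosPQ : ∀ {P Q} → PDominates P Q → PosPQ P Q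
  PDominates⇒PosPQ {P} {Q} (pP , pN) with 0≤⊎<0 Q
  ... | inj₁ nQ = inj₁ (0<⇒0≤ pP , nQ , inj₁ pP)
  ... | inj₂ qn = inj₂ (inj₁ ((pP , qn) , 0<-diff⇒< pN))

  QDominates⇒PosPQ : ∀ {P Q} → QDominates P Q → PosPQ P Q
  QDominates⇒PosPQ {P} {Q} (pQ , pN) with 0≤⊎<0 P
  ... | inj₁ nP = inj₁ (nP , 0<⇒0≤ pQ , inj₂ pQ)
  ... | inj₂ pn = inj₂ (inj₂ ((pn , pQ) , 0<-diff⇒< pN))

  mulP mulQ : ℚ → ℚ → ℚ → ℚ → ℚ
  mulP P1 Q1 P2 Q2 = P1 ℚ.* P2 ℚ.+ (Q1 ℚ.* Q2) ℚ.* D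
  mulQ P1 Q1 P2 Q2 = P1 ℚ.* Q2 ℚ.+ P2 ℚ.* Q1

  mul-PP : ∀ {P1 Q1 P2 Q2} → PDominates P1 Q1 → PDominates P2 Q2 → PDominates (mulP P1 Q1 P2 Q2) (mulQ P1 Q1 P2 Q2)
  mul-PP {P1} {Q1} {P2} {Q2} (p1 , n1) (p2 , n2) =
    squares⇒0<-sum {(Q1 ℚ.* Q2) ℚ.* D} {P1 ℚ.* P2} (0<-≡ (0<-*-mono-diff {(Q1 ℚ.* Q1) ℚ.* D} {P1 ℚ.* P1} {(Q2 ℚ.* Q2) ℚ.* D} {P2 ℚ.* P2}
        (0≤-Q²D Q1) n1 (0≤-Q²D Q2) n2) (e1 P1 Q1 P2 Q2 D))
        (0<-* p1 p2) ,
    0<-≡ (0<-* n1 n2) (e2 P1 Q1 P2 Q2 D)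
    where
    e1 : ∀ P1 Q1 P2 Q2 D → (P1 ℚ.* P1) ℚ.* (P2 ℚ.* P2) ℚ.- ((Q1 ℚ.* Q1) ℚ.* D) ℚ.* ((Q2 ℚ.* Q2) ℚ.* D)
             ≡ (P1 ℚ.* P2) ℚ.* (P1 ℚ.* P2) ℚ.- ((Q1 ℚ.* Q2) ℚ.* D) ℚ.* ((Q1 ℚ.* Q2) ℚ.* D)
    e1 = solve 5 (λ P1 Q1 P2 Q2 D → (P1 :* P1) :* (P2 :* P2) :- ((Q1 :* Q1) :* D) :* ((Q2 :* Q2) :* D)
             := (P1 :* P2) :* (P1 :* P2) :- ((Q1 :* Q2) :* D) :* ((Q1 :* Q2) :* D)) refl
    e2 : ∀ P1 Q1 P2 Q2 D → (P1 ℚ.* P1 ℚ.- (Q1 ℚ.* Q1) ℚ.* D) ℚ.* (P2 ℚ.* P2 ℚ.- (Q2 ℚ.* Q2) ℚ.* D)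
             ≡ (P1 ℚ.* P2 ℚ.+ (Q1 ℚ.* Q2) ℚ.* D) ℚ.* (P1 ℚ.* P2 ℚ.+ (Q1 ℚ.* Q2) ℚ.* D)
               ℚ.- ((P1 ℚ.* Q2 ℚ.+ P2 ℚ.* Q1) ℚ.* (P1 ℚ.* Q2 ℚ.+ P2 ℚ.* Q1)) ℚ.* D
    e2 = solve 5 (λ P1 Q1 P2 Q2 D → (P1 :* P1 :- (Q1 :* Q1) :* D) :* (P2 :* P2 :- (Q2 :* Q2) :* D)
             := (P1 :* P2 :+ (Q1 :* Q2) :* D) :* (P1 :* P2 :+ (Q1 :* Q2) :* D)
               :- ((P1 :* Q2 :+ P2 :* Q1) :* (P1 :* Q2 :+ P2 :* Q1)) :* D) refl

  mul-PQ : ∀ {P1 Q1 P2 Q2} → PDominates P1 Q1 → QDominates P2 Q2 → QDominates (mulP P1 Q1 P2 Q2) (mulQ P1 Q1 P2 Q2)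
  mul-PQ {P1} {Q1} {P2} {Q2} (p1 , n1) (q2 , y2) =
    squares⇒0<-sum {P2 ℚ.* Q1} {P1 ℚ.* Q2} (0<-cancelˡ-* 0<D (0<-≡ (0<-*-mono-diff {(Q1 ℚ.* Q1) ℚ.* D} {P1 ℚ.* P1} {P2 ℚ.* P2} {(Q2 ℚ.* Q2) ℚ.* D}
        (0≤-Q²D Q1) n1 (0≤-square P2) y2) (e1 P1 Q1 P2 Q2 D)))
        (0<-* p1 q2) ,
    0<-≡ (0<-* n1 y2) (e2 P1 Q1 P2 Q2 D)
    where
    e1 : ∀ P1 Q1 P2 Q2 D → (P1 ℚ.* P1) ℚ.* ((Q2 ℚ.* Q2) ℚ.* D) ℚ.- ((Q1 ℚ.* Q1) ℚ.* D) ℚ.* (P2 ℚ.* P2)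
             ≡ D ℚ.* ((P1 ℚ.* Q2) ℚ.* (P1 ℚ.* Q2) ℚ.- (P2 ℚ.* Q1) ℚ.* (P2 ℚ.* Q1))
    e1 = solve 5 (λ P1 Q1 P2 Q2 D → (P1 :* P1) :* ((Q2 :* Q2) :* D) :- ((Q1 :* Q1) :* D) :* (P2 :* P2)
             := D :* ((P1 :* Q2) :* (P1 :* Q2) :- (P2 :* Q1) :* (P2 :* Q1))) refl
    e2 : ∀ P1 Q1 P2 Q2 D → (P1 ℚ.* P1 ℚ.- (Q1 ℚ.* Q1) ℚ.* D) ℚ.* ((Q2 ℚ.* Q2) ℚ.* D ℚ.- P2 ℚ.* P2)
             ≡ ((P1 ℚ.* Q2 ℚ.+ P2 ℚ.* Q1) ℚ.* (P1 ℚ.* Q2 ℚ.+ P2 ℚ.* Q1)) ℚ.* D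
               ℚ.- (P1 ℚ.* P2 ℚ.+ (Q1 ℚ.* Q2) ℚ.* D) ℚ.* (P1 ℚ.* P2 ℚ.+ (Q1 ℚ.* Q2) ℚ.* D)
    e2 = solve 5 (λ P1 Q1 P2 Q2 D → (P1 :* P1 :- (Q1 :* Q1) :* D) :* ((Q2 :* Q2) :* D :- P2 :* P2)
             := ((P1 :* Q2 :+ P2 :* Q1) :* (P1 :* Q2 :+ P2 :* Q1)) :* D
               :- (P1 :* P2 :+ (Q1 :* Q2) :* D) :* (P1 :* P2 :+ (Q1 :* Q2) :* D)) refl

  mul-QQ : ∀ {P1 Q1 P2 Q2} → QDominates P1 Q1 → QDominates P2 Q2 → PDominates (mulP P1 Q1 P2 Q2) (mulQ P1 Q1 P2 Q2)
  mul-QQ {P1} {Q1} {P2} {Q2} (q1 , y1) (q2 , y2) =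
    0<-≡ (squares⇒0<-sum {P1 ℚ.* P2} {(Q1 ℚ.* Q2) ℚ.* D} (0<-≡ (0<-*-mono-diff {P1 ℚ.* P1} {(Q1 ℚ.* Q1) ℚ.* D} {P2 ℚ.* P2} {(Q2 ℚ.* Q2) ℚ.* D}
        (0≤-square P1) y1 (0≤-square P2) y2) (e1 P1 Q1 P2 Q2 D))
        (0<-* (0<-* q1 q2) 0<D))
        (ℚP.+-comm ((Q1 ℚ.* Q2) ℚ.* D) (P1 ℚ.* P2)) ,
    0<-≡ (0<-* y1 y2) (e2 P1 Q1 P2 Q2 D)
    where
    e1 : ∀ P1 Q1 P2 Q2 D → ((Q1 ℚ.* Q1) ℚ.* D) ℚ.* ((Q2 ℚ.* Q2) ℚ.* D) ℚ.- (P1 ℚ.* P1) ℚ.* (P2 ℚ.* P2)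
             ≡ ((Q1 ℚ.* Q2) ℚ.* D) ℚ.* ((Q1 ℚ.* Q2) ℚ.* D) ℚ.- (P1 ℚ.* P2) ℚ.* (P1 ℚ.* P2)
    e1 = solve 5 (λ P1 Q1 P2 Q2 D → ((Q1 :* Q1) :* D) :* ((Q2 :* Q2) :* D) :- (P1 :* P1) :* (P2 :* P2)
             := ((Q1 :* Q2) :* D) :* ((Q1 :* Q2) :* D) :- (P1 :* P2) :* (P1 :* P2)) refl
    e2 : ∀ P1 Q1 P2 Q2 D → ((Q1 ℚ.* Q1) ℚ.* D ℚ.- P1 ℚ.* P1) ℚ.* ((Q2 ℚ.* Q2) ℚ.* D ℚ.- P2 ℚ.* P2)
             ≡ (P1 ℚ.* P2 ℚ.+ (Q1 ℚ.* Q2) ℚ.* D) ℚ.* (P1 ℚ.* P2 ℚ.+ (Q1 ℚ.* Q2) ℚ.* D)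
               ℚ.- ((P1 ℚ.* Q2 ℚ.+ P2 ℚ.* Q1) ℚ.* (P1 ℚ.* Q2 ℚ.+ P2 ℚ.* Q1)) ℚ.* D
    e2 = solve 5 (λ P1 Q1 P2 Q2 D → ((Q1 :* Q1) :* D :- P1 :* P1) :* ((Q2 :* Q2) :* D :- P2 :* P2)
             := (P1 :* P2 :+ (Q1 :* Q2) :* D) :* (P1 :* P2 :+ (Q1 :* Q2) :* D)
               :- ((P1 :* Q2 :+ P2 :* Q1) :* (P1 :* Q2 :+ P2 :* Q1)) :* D) refl

  mulP-comm : ∀ P1 Q1 P2 Q2 → mulP P2 Q2 P1 Q1 ≡ mulP P1 Q1 P2 Q2
  mulP-comm P1 Q1 P2 Q2 = e P1 Q1 P2 Q2 D
    where
    e : ∀ P1 Q1 P2 Q2 D → P2 ℚ.* P1 ℚ.+ (Q2 ℚ.* Q1) ℚ.* D ≡ P1 ℚ.* P2 ℚ.+ (Q1 ℚ.* Q2) ℚ.* D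
    e = solve 5 (λ P1 Q1 P2 Q2 D → P2 :* P1 :+ (Q2 :* Q1) :* D := P1 :* P2 :+ (Q1 :* Q2) :* D) refl

  mulQ-comm : ∀ P1 Q1 P2 Q2 → mulQ P2 Q2 P1 Q1 ≡ mulQ P1 Q1 P2 Q2
  mulQ-comm P1 Q1 P2 Q2 = ℚP.+-comm (P2 ℚ.* Q1) (P1 ℚ.* Q2)

  PosPQ-mul : ∀ {P1 Q1 P2 Q2} → PosPQ P1 Q1 → PosPQ P2 Q2 → PosPQ (mulP P1 Q1 P2 Q2) (mulQ P1 Q1 P2 Q2)
  PosPQ-mul {P1} {Q1} {P2} {Q2} u v with dominates u | dominates v
  ... | inj₁ x1 | inj₁ x2 = PDominates⇒PosPQ (mul-PP {P1} {Q1} {P2} {Q2} x1 x2)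
  ... | inj₁ x1 | inj₂ y2 = QDominates⇒PosPQ (mul-PQ {P1} {Q1} {P2} {Q2} x1 y2)
  ... | inj₂ y1 | inj₁ x2 = QDominates⇒PosPQ (subst₂ QDominates (mulP-comm P1 Q1 P2 Q2) (mulQ-comm P1 Q1 P2 Q2) (mul-PQ {P2} {Q2} {P1} {Q1} x2 y1))
  ... | inj₂ y1 | inj₂ y2 = PDominates⇒PosPQ (mul-QQ {P1} {Q1} {P2} {Q2} y1 y2)

  PosPQ-cancel-scale : ∀ {l P Q} → 0< l → PosPQ (l ℚ.* P) (l ℚ.* Q) → PosPQ P Q
  PosPQ-cancel-scale {l} {P} {Q} pl u with dominates u
  ... | inj₁ (p , n) = PDominates⇒PosPQ (0<-cancelˡ-* pl p , 0<-cancelˡ-* (0<-* pl pl) (0<-≡ n (e l P Q D)))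
    where
    e : ∀ l P Q D → (l ℚ.* P) ℚ.* (l ℚ.* P) ℚ.- ((l ℚ.* Q) ℚ.* (l ℚ.* Q)) ℚ.* D ≡ (l ℚ.* l) ℚ.* (P ℚ.* P ℚ.- (Q ℚ.* Q) ℚ.* D)
    e = solve 4 (λ l P Q D → (l :* P) :* (l :* P) :- ((l :* Q) :* (l :* Q)) :* D := (l :* l) :* (P :* P :- (Q :* Q) :* D)) refl
  ... | inj₂ (q , n) = QDominates⇒PosPQ (0<-cancelˡ-* pl q , 0<-cancelˡ-* (0<-* pl pl) (0<-≡ n (e l P Q D)))
    where
    e : ∀ l P Q D → ((l ℚ.* Q) ℚ.* (l ℚ.* Q)) ℚ.* D ℚ.- (l ℚ.* P) ℚ.* (l ℚ.* P) ≡ (l ℚ.* l) ℚ.* ((Q ℚ.* Q) ℚ.* D ℚ.- P ℚ.* P)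
    e = solve 4 (λ l P Q D → ((l :* Q) :* (l :* Q)) :* D :- (l :* P) :* (l :* P) := (l :* l) :* ((Q :* Q) :* D :- P :* P)) refl

  PosPQ-+-0< : ∀ {q P Q} → 0< q → PosPQ P Q → PosPQ (q ℚ.+ P) Q
  PosPQ-+-0< {q} {P} {Q} pq u with dominates u
  ... | inj₁ (p , n) = PDominates⇒PosPQ (0<-+ pq p , 0<-≡ (0<-+ n (0<-* pq (0<-+ pq (0<-+ p p)))) (e q P Q D))
    where
    e : ∀ q P Q D → (P ℚ.* P ℚ.- (Q ℚ.* Q) ℚ.* D) ℚ.+ q ℚ.* (q ℚ.+ (P ℚ.+ P)) ≡ (q ℚ.+ P) ℚ.* (q ℚ.+ P) ℚ.- (Q ℚ.* Q) ℚ.* D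
    e = solve 4 (λ q P Q D → (P :* P :- (Q :* Q) :* D) :+ q :* (q :+ (P :+ P)) := (q :+ P) :* (q :+ P) :- (Q :* Q) :* D) refl
  ... | inj₂ (qq , y) with 0<-trichotomy (norm⁺ (q ℚ.+ P) Q)
  ...   | inj₂ (inj₂ n') = QDominates⇒PosPQ (qq , 0<-≡ n' (sym (norm⁻≡-norm⁺ (q ℚ.+ P) Q)))
  ...   | inj₂ (inj₁ z) = ⊥-elim (0≮0 (subst 0<_ (proj₂ (norm⁺≡0⇒zero (q ℚ.+ P) Q z)) qq))
  ...   | inj₁ n' with 0<⊎0≤-neg (q ℚ.+ P)
  ...     | inj₁ p' = PDominates⇒PosPQ (p' , n')
  ...     | inj₂ h = ⊥-elim (0≮0 (0<-≡ (0<-+ (0<-+ n' y) (0<-* pq (0≤-+0< (0≤-+ h h) pq))) (e q P Q D)))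
    where
    e : ∀ q P Q D → ((q ℚ.+ P) ℚ.* (q ℚ.+ P) ℚ.- (Q ℚ.* Q) ℚ.* D ℚ.+ ((Q ℚ.* Q) ℚ.* D ℚ.- P ℚ.* P))
                    ℚ.+ q ℚ.* ((ℚ.- (q ℚ.+ P)) ℚ.+ (ℚ.- (q ℚ.+ P)) ℚ.+ q) ≡ 0ℚ
    e = solve 4 (λ q P Q D → ((q :+ P) :* (q :+ P) :- (Q :* Q) :* D :+ ((Q :* Q) :* D :- P :* P))
                    :+ q :* ((:- (q :+ P)) :+ (:- (q :+ P)) :+ q) := con 0ℚ) refl

  -- With x = P1 + Q1√D and x̄ = P1 - Q1√D > 0: (x + y) x̄ = N(x) + y x̄ > 0, then multiply by x and cancel N(x) > 0.
  add-P : ∀ {P1 Q1 P2 Q2} → PDominates P1 Q1 → PosPQ P2 Q2 → PosPQ (P1 ℚ.+ P2) (Q1 ℚ.+ Q2)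
  add-P {P1} {Q1} {P2} {Q2} (p1 , n1) v = PosPQ-cancel-scale {norm⁺ P1 Q1} n1 (subst₂ PosPQ (e3 P1 Q1 P2 Q2 D) (e4 P1 Q1 P2 Q2 D) z)
    where
    conj-pos : PDominates P1 (ℚ.- Q1)
    conj-pos = p1 , 0<-≡ n1 (e0 P1 Q1 D)
      where
      e0 : ∀ P1 Q1 D → P1 ℚ.* P1 ℚ.- (Q1 ℚ.* Q1) ℚ.* D ≡ P1 ℚ.* P1 ℚ.- ((ℚ.- Q1) ℚ.* (ℚ.- Q1)) ℚ.* D
      e0 = solve 3 (λ P1 Q1 D → P1 :* P1 :- (Q1 :* Q1) :* D := P1 :* P1 :- ((:- Q1) :* (:- Q1)) :* D) refl
    vu = PosPQ-mul {P2} {Q2} {P1} {ℚ.- Q1} v (PDominates⇒PosPQ conj-pos)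
    wu : PosPQ (mulP (P1 ℚ.+ P2) (Q1 ℚ.+ Q2) P1 (ℚ.- Q1)) (mulQ (P1 ℚ.+ P2) (Q1 ℚ.+ Q2) P1 (ℚ.- Q1))
    wu = subst₂ PosPQ (e1 P1 Q1 P2 Q2 D) (e2 P1 Q1 P2 Q2) (PosPQ-+-0< n1 vu)
      where
      e1 : ∀ P1 Q1 P2 Q2 D → (P1 ℚ.* P1 ℚ.- (Q1 ℚ.* Q1) ℚ.* D) ℚ.+ (P2 ℚ.* P1 ℚ.+ (Q2 ℚ.* (ℚ.- Q1)) ℚ.* D)
                            ≡ (P1 ℚ.+ P2) ℚ.* P1 ℚ.+ ((Q1 ℚ.+ Q2) ℚ.* (ℚ.- Q1)) ℚ.* D
      e1 = solve 5 (λ P1 Q1 P2 Q2 D → (P1 :* P1 :- (Q1 :* Q1) :* D) :+ (P2 :* P1 :+ (Q2 :* (:- Q1)) :* D)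
                            := (P1 :+ P2) :* P1 :+ ((Q1 :+ Q2) :* (:- Q1)) :* D) refl
      e2 : ∀ P1 Q1 P2 Q2 → P2 ℚ.* (ℚ.- Q1) ℚ.+ P1 ℚ.* Q2 ≡ (P1 ℚ.+ P2) ℚ.* (ℚ.- Q1) ℚ.+ P1 ℚ.* (Q1 ℚ.+ Q2)
      e2 = solve 4 (λ P1 Q1 P2 Q2 → P2 :* (:- Q1) :+ P1 :* Q2 := (P1 :+ P2) :* (:- Q1) :+ P1 :* (Q1 :+ Q2)) refl
    A = mulP (P1 ℚ.+ P2) (Q1 ℚ.+ Q2) P1 (ℚ.- Q1)
    B = mulQ (P1 ℚ.+ P2) (Q1 ℚ.+ Q2) P1 (ℚ.- Q1)
    z = PosPQ-mul {A} {B} {P1} {Q1} wu (PDominates⇒PosPQ (p1 , n1))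
    e3 : ∀ P1 Q1 P2 Q2 D → (((P1 ℚ.+ P2) ℚ.* P1 ℚ.+ ((Q1 ℚ.+ Q2) ℚ.* (ℚ.- Q1)) ℚ.* D) ℚ.* P1 ℚ.+
                ((((P1 ℚ.+ P2) ℚ.* (ℚ.- Q1) ℚ.+ P1 ℚ.* (Q1 ℚ.+ Q2))) ℚ.* Q1) ℚ.* D)
              ≡ (P1 ℚ.* P1 ℚ.- (Q1 ℚ.* Q1) ℚ.* D) ℚ.* (P1 ℚ.+ P2)
    e3 = solve 5 (λ P1 Q1 P2 Q2 D → (((P1 :+ P2) :* P1 :+ ((Q1 :+ Q2) :* (:- Q1)) :* D) :* P1 :+
                ((((P1 :+ P2) :* (:- Q1) :+ P1 :* (Q1 :+ Q2))) :* Q1) :* D)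
              := (P1 :* P1 :- (Q1 :* Q1) :* D) :* (P1 :+ P2)) refl
    e4 : ∀ P1 Q1 P2 Q2 D → (((P1 ℚ.+ P2) ℚ.* P1 ℚ.+ ((Q1 ℚ.+ Q2) ℚ.* (ℚ.- Q1)) ℚ.* D) ℚ.* Q1 ℚ.+
                P1 ℚ.* ((P1 ℚ.+ P2) ℚ.* (ℚ.- Q1) ℚ.+ P1 ℚ.* (Q1 ℚ.+ Q2)))
              ≡ (P1 ℚ.* P1 ℚ.- (Q1 ℚ.* Q1) ℚ.* D) ℚ.* (Q1 ℚ.+ Q2)
    e4 = solve 5 (λ P1 Q1 P2 Q2 D → (((P1 :+ P2) :* P1 :+ ((Q1 :+ Q2) :* (:- Q1)) :* D) :* Q1 :+
                P1 :* ((P1 :+ P2) :* (:- Q1) :+ P1 :* (Q1 :+ Q2)))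
              := (P1 :* P1 :- (Q1 :* Q1) :* D) :* (Q1 :+ Q2)) refl

  add-QQ : ∀ {P1 Q1 P2 Q2} → QDominates P1 Q1 → QDominates P2 Q2 → QDominates (P1 ℚ.+ P2) (Q1 ℚ.+ Q2)
  add-QQ {P1} {Q1} {P2} {Q2} (q1 , y1) (q2 , y2) = 0<-+ q1 q2 , 0<-≡ (0<-+ (0<-+ y1 y2) (0<-+ ba ba)) (e2 P1 Q1 P2 Q2 D)
    where
    ba : 0< ((Q1 ℚ.* Q2) ℚ.* D ℚ.- P1 ℚ.* P2)
    ba = squares⇒0<-diff {P1 ℚ.* P2} {(Q1 ℚ.* Q2) ℚ.* D} (0<-≡ (0<-*-mono-diff {P1 ℚ.* P1} {(Q1 ℚ.* Q1) ℚ.* D} {P2 ℚ.* P2} {(Q2 ℚ.* Q2) ℚ.* D}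
        (0≤-square P1) y1 (0≤-square P2) y2) (e1 P1 Q1 P2 Q2 D))
        (0<-* (0<-* q1 q2) 0<D)
      where
      e1 : ∀ P1 Q1 P2 Q2 D → ((Q1 ℚ.* Q1) ℚ.* D) ℚ.* ((Q2 ℚ.* Q2) ℚ.* D) ℚ.- (P1 ℚ.* P1) ℚ.* (P2 ℚ.* P2)
               ≡ ((Q1 ℚ.* Q2) ℚ.* D) ℚ.* ((Q1 ℚ.* Q2) ℚ.* D) ℚ.- (P1 ℚ.* P2) ℚ.* (P1 ℚ.* P2)
      e1 = solve 5 (λ P1 Q1 P2 Q2 D → ((Q1 :* Q1) :* D) :* ((Q2 :* Q2) :* D) :- (P1 :* P1) :* (P2 :* P2)
               := ((Q1 :* Q2) :* D) :* ((Q1 :* Q2) :* D) :- (P1 :* P2) :* (P1 :* P2)) refl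
    e2 : ∀ P1 Q1 P2 Q2 D → (((Q1 ℚ.* Q1) ℚ.* D ℚ.- P1 ℚ.* P1) ℚ.+ ((Q2 ℚ.* Q2) ℚ.* D ℚ.- P2 ℚ.* P2)) ℚ.+
               (((Q1 ℚ.* Q2) ℚ.* D ℚ.- P1 ℚ.* P2) ℚ.+ ((Q1 ℚ.* Q2) ℚ.* D ℚ.- P1 ℚ.* P2))
             ≡ ((Q1 ℚ.+ Q2) ℚ.* (Q1 ℚ.+ Q2)) ℚ.* D ℚ.- (P1 ℚ.+ P2) ℚ.* (P1 ℚ.+ P2)
    e2 = solve 5 (λ P1 Q1 P2 Q2 D → (((Q1 :* Q1) :* D :- P1 :* P1) :+ ((Q2 :* Q2) :* D :- P2 :* P2)) :+
               (((Q1 :* Q2) :* D :- P1 :* P2) :+ ((Q1 :* Q2) :* D :- P1 :* P2))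
             := ((Q1 :+ Q2) :* (Q1 :+ Q2)) :* D :- (P1 :+ P2) :* (P1 :+ P2)) refl

  PosPQ-add : ∀ {P1 Q1 P2 Q2} → PosPQ P1 Q1 → PosPQ P2 Q2 → PosPQ (P1 ℚ.+ P2) (Q1 ℚ.+ Q2)
  PosPQ-add {P1} {Q1} {P2} {Q2} u v with dominates u
  ... | inj₁ x1 = add-P {P1} {Q1} {P2} {Q2} x1 v
  ... | inj₂ y1 with dominates v
  ...   | inj₁ x2 = subst₂ PosPQ (ℚP.+-comm P2 P1) (ℚP.+-comm Q2 Q1) (add-P {P2} {Q2} {P1} {Q1} x2 u)
  ...   | inj₂ y2 = QDominates⇒PosPQ (add-QQ {P1} {Q1} {P2} {Q2} y1 y2)

  PosPQ-asym : ∀ {P Q} → PosPQ P Q → PosPQ (ℚ.- P) (ℚ.- Q) → ⊥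
  PosPQ-asym {P} {Q} u v with dominates u | dominates v
  ... | inj₁ (p , _) | inj₁ (p' , _) = 0<∧0<-neg⇒⊥ p p'
  ... | inj₁ (_ , n) | inj₂ (_ , y) = 0<∧0<-neg⇒⊥ n (0<-≡ y (e P Q D))
    where
    e : ∀ P Q D → ((ℚ.- Q) ℚ.* (ℚ.- Q)) ℚ.* D ℚ.- (ℚ.- P) ℚ.* (ℚ.- P) ≡ ℚ.- (P ℚ.* P ℚ.- (Q ℚ.* Q) ℚ.* D)
    e = solve 3 (λ P Q D → ((:- Q) :* (:- Q)) :* D :- (:- P) :* (:- P) := :- (P :* P :- (Q :* Q) :* D)) refl
  ... | inj₂ (_ , y) | inj₁ (_ , n) = 0<∧0<-neg⇒⊥ y (0<-≡ n (e P Q D))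
    where
    e : ∀ P Q D → (ℚ.- P) ℚ.* (ℚ.- P) ℚ.- ((ℚ.- Q) ℚ.* (ℚ.- Q)) ℚ.* D ≡ ℚ.- ((Q ℚ.* Q) ℚ.* D ℚ.- P ℚ.* P)
    e = solve 3 (λ P Q D → (:- P) :* (:- P) :- ((:- Q) :* (:- Q)) :* D := :- ((Q :* Q) :* D :- P :* P)) refl
  ... | inj₂ (q , _) | inj₂ (q' , _) = 0<∧0<-neg⇒⊥ q q'

  ¬PosPQ-0 : ¬ PosPQ 0ℚ 0ℚ
  ¬PosPQ-0 u with dominates u
  ... | inj₁ (p , _) = 0≮0 p
  ... | inj₂ (q , _) = 0≮0 q

  PosPQ-trichotomy : ∀ P Q → PosPQ P Q ⊎ ((P ≡ 0ℚ) × (Q ≡ 0ℚ)) ⊎ PosPQ (ℚ.- P) (ℚ.- Q)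
  PosPQ-trichotomy P Q with 0<-trichotomy (norm⁺ P Q)
  ... | inj₂ (inj₁ z) = inj₂ (inj₁ (norm⁺≡0⇒zero P Q z))
  ... | inj₁ n with 0<-trichotomy P
  ...   | inj₁ p = inj₁ (PDominates⇒PosPQ (p , n))
  ...   | inj₂ (inj₁ z) = ⊥-elim (P≡0⇒¬0<norm⁺ P Q z n)
  ...   | inj₂ (inj₂ p') = inj₂ (inj₂ (PDominates⇒PosPQ (p' , 0<-≡ n (e P Q D))))
    where
    e : ∀ P Q D → P ℚ.* P ℚ.- (Q ℚ.* Q) ℚ.* D ≡ (ℚ.- P) ℚ.* (ℚ.- P) ℚ.- ((ℚ.- Q) ℚ.* (ℚ.- Q)) ℚ.* D
    e = solve 3 (λ P Q D → P :* P :- (Q :* Q) :* D := (:- P) :* (:- P) :- ((:- Q) :* (:- Q)) :* D) refl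
  PosPQ-trichotomy P Q | inj₂ (inj₂ n') with 0<-trichotomy Q
  ...   | inj₁ q = inj₁ (QDominates⇒PosPQ (q , 0<-≡ n' (sym (norm⁻≡-norm⁺ P Q))))
  ...   | inj₂ (inj₁ z) = ⊥-elim (Q≡0⇒¬0<norm⁻ P Q z (0<-≡ n' (sym (norm⁻≡-norm⁺ P Q))))
  ...   | inj₂ (inj₂ q') = inj₂ (inj₂ (QDominates⇒PosPQ (q' , 0<-≡ n' (e P Q D))))
    where
    e : ∀ P Q D → ℚ.- (P ℚ.* P ℚ.- (Q ℚ.* Q) ℚ.* D) ≡ ((ℚ.- Q) ℚ.* (ℚ.- Q)) ℚ.* D ℚ.- (ℚ.- P) ℚ.* (ℚ.- P)
    e = solve 3 (λ P Q D → :- (P :* P :- (Q :* Q) :* D) := ((:- Q) :* (:- Q)) :* D :- (:- P) :* (:- P)) refl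

0<4n : ∀ {n} → 1 ≤ n → 0 ℕ.< 4 ℕ.* n
0<4n {n} = ℕP.*-mono-≤ {1} {4} {1} {n} (ℕ.s≤s ℕ.z≤n)

-- A² < m² and A ≡ m (mod 2) force A ≤ m - 2, and then A² + 4n ≤ (m-2)² + 4(m-2) < m².
m²≢A²+4n : ∀ {m n} → 1 ≤ n → n + 2 ≤ m → ∀ A → A ℕ.* A + 4 ℕ.* n ≢ m ℕ.* m
m²≢A²+4n {m} {n} 1≤n n+2≤m A eq with ℕP.<-cmp A m
... | tri≈ _ refl _ = ℕP.<-irrefl (sym eq) (ℕP.m<m+n (A ℕ.* A) (0<4n 1≤n))
... | tri> _ _ m<A = ℕP.<-irrefl (sym eq) (ℕP.≤-<-trans (ℕP.*-mono-≤ (ℕP.<⇒≤ m<A) (ℕP.<⇒≤ m<A)) (ℕP.m<m+n (A ℕ.* A) (0<4n 1≤n)))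
... | tri< A<m _ _ with ℕP.m≤n⇒∃[o]m+o≡n A<m
...   | zero , e = ℕP.even≢odd (2 ℕ.* n) A (trans (4n≡2[2n] n) (ℕP.+-cancelˡ-≡ (A ℕ.* A) _ _ (trans eq (trans (cong (λ z → z ℕ.* z) (sym e)) (square-suc A)))))
  where
  4n≡2[2n] : ∀ n → 2 ℕ.* (2 ℕ.* n) ≡ 4 ℕ.* n
  4n≡2[2n] = ℕ-Solver.solve-∀
  square-suc : ∀ A → suc (A + 0) ℕ.* suc (A + 0) ≡ A ℕ.* A + suc (2 ℕ.* A)
  square-suc = ℕ-Solver.solve-∀
...   | suc f , e = ℕP.<-irrefl eq (ℕP.≤-<-trans (ℕP.+-monoʳ-≤ (A ℕ.* A) (ℕP.*-monoʳ-≤ 4 n≤A+f)) lt)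
  where
  n≤A+f : n ≤ A + f
  n≤A+f = ℕP.+-cancelʳ-≤ 2 n (A + f) (subst (n + 2 ≤_) (trans (sym e) (l A f)) n+2≤m)
    where
    l : ∀ A f → suc A + suc f ≡ A + f + 2
    l = ℕ-Solver.solve-∀
  lt : A ℕ.* A + 4 ℕ.* (A + f) ℕ.< m ℕ.* m
  lt = subst (A ℕ.* A + 4 ℕ.* (A + f) ℕ.<_) (trans (l A f) (cong (λ z → z ℕ.* z) e)) (ℕP.m<m+n _ (ℕ.s≤s ℕ.z≤n))
    where
    l : ∀ A f → A ℕ.* A + 4 ℕ.* (A + f) + suc (3 + f ℕ.* f + 2 ℕ.* A ℕ.* f) ≡ (suc A + suc f) ℕ.* (suc A + suc f)
    l = ℕ-Solver.solve-∀

module Discriminant (m n : ℕ) (1≤n : 1 ≤ n) (n+2≤m : n + 2 ≤ m) where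
  open Field m n using (Dq)

  disc : ℕ
  disc = m ℕ.* m ∸ 4 ℕ.* n

  4n≤m² : 4 ℕ.* n ≤ m ℕ.* m
  4n≤m² = ℕP.≤-trans (ℕP.≤-trans (ℕP.m≤n+m (4 ℕ.* n) (n ℕ.* n + 4)) (ℕP.≤-reflexive (l n))) (ℕP.*-mono-≤ n+2≤m n+2≤m)
    where
    l : ∀ n → n ℕ.* n + 4 + 4 ℕ.* n ≡ (n + 2) ℕ.* (n + 2)
    l = ℕ-Solver.solve-∀

  disc+4n≡m² : disc + 4 ℕ.* n ≡ m ℕ.* m
  disc+4n≡m² = ℕP.m∸n+n≡m 4n≤m²

  Dq≡disc : Dq ≡ fromℤ (+ disc)
  Dq≡disc = sym (begin
      fromℤ (+ disc)
        ≡⟨ cong fromℤ disc≡m²-4n ⟩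
      fromℤ (+ m ℤ.* + m ℤ.+ ℤ.- (+ 4 ℤ.* + n))
        ≡⟨ fromℤ-+ (+ m ℤ.* + m) (ℤ.- (+ 4 ℤ.* + n)) ⟩
      fromℤ (+ m ℤ.* + m) ℚ.+ fromℤ (ℤ.- (+ 4 ℤ.* + n))
        ≡⟨ cong₂ ℚ._+_ (fromℤ-* (+ m) (+ m)) (trans (fromℤ-neg (+ 4 ℤ.* + n)) (cong ℚ.-_ (fromℤ-* (+ 4) (+ n)))) ⟩
      Dq ∎)
    where
    open ≡-Reasoning
    disc≡m²-4n : + disc ≡ + m ℤ.* + m ℤ.+ ℤ.- (+ 4 ℤ.* + n)
    disc≡m²-4n = sym (trans (cong₂ (λ a b → a ℤ.+ ℤ.- b) (ℤP.+◃n≡+n (m ℕ.* m)) (ℤP.+◃n≡+n (4 ℕ.* n)))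
                (trans (ℤP.m-n≡m⊖n (m ℕ.* m) (4 ℕ.* n)) (ℤP.⊖-≥ 4n≤m²)))

  -- A rational square root of an integer has denominator 1.
  disc-nonsquare : ∀ r → r ℚ.* r ≢ fromℤ (+ disc)
  disc-nonsquare r@(mkℚ a d-1 c) eq with ℚᵘP.≃-trans (ℚᵘP.≃-sym (ℚP.toℚᵘ-homo-* r r))
      (ℚᵘP.≃-trans (ℚᵘP.≃-reflexive (cong ℚ.toℚᵘ eq)) (toℚᵘ-fromℤ (+ disc)))
  ... | ℚᵘ.*≡* e = m²≢A²+4n 1≤n n+2≤m A (trans (cong (_+ 4 ℕ.* n) A²≡disc) disc+4n≡m²)
    where
    A = ℤ.∣ a ∣
    d = suc d-1
    coprime : Coprime.Coprime A d
    coprime = Coprime.recompute c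
    A²≡disc·d² : A ℕ.* A ℕ.* 1 ≡ disc ℕ.* (d ℕ.* d)
    A²≡disc·d² = trans (sym (trans (ℤP.abs-* (a ℤ.* a) (+ 1)) (cong (ℕ._* 1) (ℤP.abs-* a a))))
           (trans (cong ℤ.∣_∣ e) (ℤP.abs-* (+ disc) (+ (d ℕ.* d))))
    d∣A² : d ∣ A ℕ.* A
    d∣A² = divides (disc ℕ.* d) (trans (sym (ℕP.*-identityʳ (A ℕ.* A))) (trans A²≡disc·d² (sym (ℕP.*-assoc disc d d))))
    d≡1 : d ≡ 1
    d≡1 = coprime (Coprime.coprime-divisor (Coprime.sym coprime) d∣A² , ∣-refl)
    A²≡disc : A ℕ.* A ≡ disc
    A²≡disc = trans (sym (ℕP.*-identityʳ (A ℕ.* A))) (trans A²≡disc·d² (trans (cong (λ z → disc ℕ.* (z ℕ.* z)) d≡1) (ℕP.*-identityʳ disc)))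

  Dq-nonsquare : ∀ P Q → P ℚ.* P ≡ (Q ℚ.* Q) ℚ.* Dq → Q ≡ 0ℚ
  Dq-nonsquare P Q h with Q ℚP.≟ 0ℚ
  ... | yes Q≡0 = Q≡0
  ... | no Q≢0 = ⊥-elim (disc-nonsquare (P ℚ.* w) (trans [P/Q]²≡Dq Dq≡disc))
    where
    instance _ = ℚ.≢-nonZero Q≢0
    w = ℚ.1/ Q
    e1 : ∀ P w → (P ℚ.* w) ℚ.* (P ℚ.* w) ≡ (P ℚ.* P) ℚ.* (w ℚ.* w)
    e1 = solve 2 (λ P w → (P :* w) :* (P :* w) := (P :* P) :* (w :* w)) refl
    e2 : ∀ w Q D → ((Q ℚ.* Q) ℚ.* D) ℚ.* (w ℚ.* w) ≡ D ℚ.* ((Q ℚ.* w) ℚ.* (Q ℚ.* w))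
    e2 = solve 3 (λ w Q D → ((Q :* Q) :* D) :* (w :* w) := D :* ((Q :* w) :* (Q :* w))) refl
    [P/Q]²≡Dq : (P ℚ.* w) ℚ.* (P ℚ.* w) ≡ Dq
    [P/Q]²≡Dq = trans (e1 P w) (trans (cong (ℚ._* (w ℚ.* w)) h) (trans (e2 w Q Dq)
           (trans (cong (λ z → Dq ℚ.* (z ℚ.* z)) (ℚP.*-inverseʳ Q)) (ℚP.*-identityʳ Dq))))

  0<Dq : 0< Dq
  0<Dq = subst 0<_ (sym Dq≡disc) (fromℤ-mono-< (ℤ.+<+ 0<disc))
    where
    0<disc : 0 ℕ.< disc
    0<disc with disc | disc+4n≡m²
    ... | zero | e = ⊥-elim (ℕP.<-irrefl e (ℕP.<-≤-trans (ℕP.m<m+n (4 ℕ.* n) (ℕ.s≤s ℕ.z≤n)) (ℕP.≤-trans (ℕP.≤-reflexive (l n)) (ℕP.*-mono-≤ n+2≤m n+2≤m))))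
      where
      l : ∀ n → 4 ℕ.* n + suc (n ℕ.* n + 3) ≡ (n + 2) ℕ.* (n + 2)
      l = ℕ-Solver.solve-∀
    ... | suc _ | _ = ℕ.s≤s ℕ.z≤n

module QuadraticField (m n : ℕ) where
  open Field m n public

  0K 1K : K
  0K = ι (+ 0)
  1K = ι (+ 1)

  ⊕-assoc : ∀ x y z → (x ⊕ y) ⊕ z ≡ x ⊕ (y ⊕ z)
  ⊕-assoc (a , b) (c , d) (e , f) = cong₂ _,_ (ℚP.+-assoc a c e) (ℚP.+-assoc b d f)

  ⊕-comm : ∀ x y → x ⊕ y ≡ y ⊕ x
  ⊕-comm (a , b) (c , d) = cong₂ _,_ (ℚP.+-comm a c) (ℚP.+-comm b d)

  ⊕-idˡ : ∀ x → 0K ⊕ x ≡ x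
  ⊕-idˡ (a , b) = cong₂ _,_ (ℚP.+-identityˡ a) (ℚP.+-identityˡ b)

  ⊕-idʳ : ∀ x → x ⊕ 0K ≡ x
  ⊕-idʳ (a , b) = cong₂ _,_ (ℚP.+-identityʳ a) (ℚP.+-identityʳ b)

  ⊖-invˡ : ∀ x → (⊖ x) ⊕ x ≡ 0K
  ⊖-invˡ (a , b) = cong₂ _,_ (ℚP.+-inverseˡ a) (ℚP.+-inverseˡ b)

  ⊖-invʳ : ∀ x → x ⊕ (⊖ x) ≡ 0K
  ⊖-invʳ (a , b) = cong₂ _,_ (ℚP.+-inverseʳ a) (ℚP.+-inverseʳ b)

  ⊛-comm : ∀ x y → x ⊛ y ≡ y ⊛ x
  ⊛-comm (a , b) (c , d) = cong₂ _,_ (e1 a b c d nq) (e2 a b c d mq)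
    where
    e1 : ∀ a b c d N → a ℚ.* c ℚ.- N ℚ.* (b ℚ.* d) ≡ c ℚ.* a ℚ.- N ℚ.* (d ℚ.* b)
    e1 = solve 5 (λ a b c d N → a :* c :- N :* (b :* d) := c :* a :- N :* (d :* b)) refl
    e2 : ∀ a b c d M → (a ℚ.* d ℚ.+ b ℚ.* c) ℚ.+ M ℚ.* (b ℚ.* d) ≡ (c ℚ.* b ℚ.+ d ℚ.* a) ℚ.+ M ℚ.* (d ℚ.* b)
    e2 = solve 5 (λ a b c d M → (a :* d :+ b :* c) :+ M :* (b :* d) := (c :* b :+ d :* a) :+ M :* (d :* b)) refl

  ⊛-assoc : ∀ x y z → (x ⊛ y) ⊛ z ≡ x ⊛ (y ⊛ z)
  ⊛-assoc (a , b) (c , d) (e , f) = cong₂ _,_ (e1 a b c d e f mq nq) (e2 a b c d e f mq nq)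
    where
    e1 : ∀ a b c d e f M N →
         (a ℚ.* c ℚ.- N ℚ.* (b ℚ.* d)) ℚ.* e ℚ.- N ℚ.* (((a ℚ.* d ℚ.+ b ℚ.* c) ℚ.+ M ℚ.* (b ℚ.* d)) ℚ.* f)
       ≡ a ℚ.* (c ℚ.* e ℚ.- N ℚ.* (d ℚ.* f)) ℚ.- N ℚ.* (b ℚ.* ((c ℚ.* f ℚ.+ d ℚ.* e) ℚ.+ M ℚ.* (d ℚ.* f)))
    e1 = solve 8 (λ a b c d e f M N →
         (a :* c :- N :* (b :* d)) :* e :- N :* (((a :* d :+ b :* c) :+ M :* (b :* d)) :* f)
       := a :* (c :* e :- N :* (d :* f)) :- N :* (b :* ((c :* f :+ d :* e) :+ M :* (d :* f)))) refl
    e2 : ∀ a b c d e f M N →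
         ((a ℚ.* c ℚ.- N ℚ.* (b ℚ.* d)) ℚ.* f ℚ.+ ((a ℚ.* d ℚ.+ b ℚ.* c) ℚ.+ M ℚ.* (b ℚ.* d)) ℚ.* e) ℚ.+
           M ℚ.* (((a ℚ.* d ℚ.+ b ℚ.* c) ℚ.+ M ℚ.* (b ℚ.* d)) ℚ.* f)
       ≡ (a ℚ.* ((c ℚ.* f ℚ.+ d ℚ.* e) ℚ.+ M ℚ.* (d ℚ.* f)) ℚ.+ b ℚ.* (c ℚ.* e ℚ.- N ℚ.* (d ℚ.* f))) ℚ.+
           M ℚ.* (b ℚ.* ((c ℚ.* f ℚ.+ d ℚ.* e) ℚ.+ M ℚ.* (d ℚ.* f)))
    e2 = solve 8 (λ a b c d e f M N →
         ((a :* c :- N :* (b :* d)) :* f :+ ((a :* d :+ b :* c) :+ M :* (b :* d)) :* e) :+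
           M :* (((a :* d :+ b :* c) :+ M :* (b :* d)) :* f)
       := (a :* ((c :* f :+ d :* e) :+ M :* (d :* f)) :+ b :* (c :* e :- N :* (d :* f))) :+
           M :* (b :* ((c :* f :+ d :* e) :+ M :* (d :* f)))) refl

  ⊛-idˡ : ∀ x → 1K ⊛ x ≡ x
  ⊛-idˡ (a , b) = cong₂ _,_ (e1 a b nq) (e2 a b mq)
    where
    e1 : ∀ a b N → 1ℚ ℚ.* a ℚ.- N ℚ.* (0ℚ ℚ.* b) ≡ a
    e1 = solve 3 (λ a b N → con 1ℚ :* a :- N :* (con 0ℚ :* b) := a) refl
    e2 : ∀ a b M → (1ℚ ℚ.* b ℚ.+ 0ℚ ℚ.* a) ℚ.+ M ℚ.* (0ℚ ℚ.* b) ≡ b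
    e2 = solve 3 (λ a b M → (con 1ℚ :* b :+ con 0ℚ :* a) :+ M :* (con 0ℚ :* b) := b) refl

  ⊛-idʳ : ∀ x → x ⊛ 1K ≡ x
  ⊛-idʳ x = trans (⊛-comm x 1K) (⊛-idˡ x)

  ⊛-distribˡ : ∀ x y z → x ⊛ (y ⊕ z) ≡ (x ⊛ y) ⊕ (x ⊛ z)
  ⊛-distribˡ (a , b) (c , d) (e , f) = cong₂ _,_ (e1 a b c d e f nq) (e2 a b c d e f mq)
    where
    e1 : ∀ a b c d e f N → a ℚ.* (c ℚ.+ e) ℚ.- N ℚ.* (b ℚ.* (d ℚ.+ f)) ≡ (a ℚ.* c ℚ.- N ℚ.* (b ℚ.* d)) ℚ.+ (a ℚ.* e ℚ.- N ℚ.* (b ℚ.* f))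
    e1 = solve 7 (λ a b c d e f N → a :* (c :+ e) :- N :* (b :* (d :+ f)) := (a :* c :- N :* (b :* d)) :+ (a :* e :- N :* (b :* f))) refl
    e2 : ∀ a b c d e f M → (a ℚ.* (d ℚ.+ f) ℚ.+ b ℚ.* (c ℚ.+ e)) ℚ.+ M ℚ.* (b ℚ.* (d ℚ.+ f))
             ≡ ((a ℚ.* d ℚ.+ b ℚ.* c) ℚ.+ M ℚ.* (b ℚ.* d)) ℚ.+ ((a ℚ.* f ℚ.+ b ℚ.* e) ℚ.+ M ℚ.* (b ℚ.* f))
    e2 = solve 7 (λ a b c d e f M → (a :* (d :+ f) :+ b :* (c :+ e)) :+ M :* (b :* (d :+ f))
             := ((a :* d :+ b :* c) :+ M :* (b :* d)) :+ ((a :* f :+ b :* e) :+ M :* (b :* f))) refl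

  ⊛-distribʳ : ∀ x y z → (y ⊕ z) ⊛ x ≡ (y ⊛ x) ⊕ (z ⊛ x)
  ⊛-distribʳ x y z = trans (⊛-comm (y ⊕ z) x) (trans (⊛-distribˡ x y z) (cong₂ _⊕_ (⊛-comm x y) (⊛-comm x z)))

  K-commutativeRing : CommutativeRing _ _
  K-commutativeRing = record
    { Carrier = K ; _≈_ = _≡_ ; _+_ = _⊕_ ; _*_ = _⊛_ ; -_ = ⊖_ ; 0# = 0K ; 1# = 1K
    ; isCommutativeRing = record
      { isRing = record
        { +-isAbelianGroup = record
          { isGroup = record
            { isMonoid = record
              { isSemigroup = record
                { isMagma = record { isEquivalence = isEquivalence ; ∙-cong = cong₂ _⊕_ }
                ; assoc = ⊕-assoc }
              ; identity = ⊕-idˡ , ⊕-idʳ }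
            ; inverse = ⊖-invˡ , ⊖-invʳ
            ; ⁻¹-cong = cong ⊖_ }
          ; comm = ⊕-comm }
        ; *-cong = cong₂ _⊛_
        ; *-assoc = ⊛-assoc
        ; *-identity = ⊛-idˡ , ⊛-idʳ
        ; distrib = ⊛-distribˡ , ⊛-distribʳ }
      ; *-comm = ⊛-comm } }

  ι-+ : ∀ a b → ι (a ℤ.+ b) ≡ ι a ⊕ ι b
  ι-+ a b = cong₂ _,_ (fromℤ-+ a b) (sym (ℚP.+-identityˡ 0ℚ))

  ι-* : ∀ a b → ι (a ℤ.* b) ≡ ι a ⊛ ι b
  ι-* a b = cong₂ _,_ (trans (fromℤ-* a b) (e1 (fromℤ a) (fromℤ b) nq)) (e2 (fromℤ a) (fromℤ b) mq)
    where
    e1 : ∀ x y N → x ℚ.* y ≡ x ℚ.* y ℚ.- N ℚ.* (0ℚ ℚ.* 0ℚ)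
    e1 = solve 3 (λ x y N → x :* y := x :* y :- N :* (con 0ℚ :* con 0ℚ)) refl
    e2 : ∀ x y M → 0ℚ ≡ (x ℚ.* 0ℚ ℚ.+ 0ℚ ℚ.* y) ℚ.+ M ℚ.* (0ℚ ℚ.* 0ℚ)
    e2 = solve 3 (λ x y M → con 0ℚ := (x :* con 0ℚ :+ con 0ℚ :* y) :+ M :* (con 0ℚ :* con 0ℚ)) refl

  ι-neg : ∀ a → ι (ℤ.- a) ≡ ⊖ ι a
  ι-neg a = cong₂ _,_ (fromℤ-neg a) refl

  ι-homomorphism : ℤ.+-*-rawRing -Raw-AlmostCommutative⟶ ACR.fromCommutativeRing K-commutativeRing
  ι-homomorphism = record { ⟦_⟧ = ι ; +-homo = ι-+ ; *-homo = ι-* ; -‿homo = ι-neg ; 0-homo = refl ; 1-homo = refl }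

  coeff≟ : ∀ (a b : ℤ) → Maybe (ι a ≡ ι b)
  coeff≟ a b with a ℤ.≟ b
  ... | yes e = just (cong ι e)
  ... | no _ = nothing

  module K-Solver = RingSolver ℤ.+-*-rawRing (ACR.fromCommutativeRing K-commutativeRing) ι-homomorphism coeff≟
  open K-Solver public using ()
    renaming (solve to solveᴷ; _:+_ to _+ᴷ_; _:*_ to _*ᴷ_; _:-_ to _-ᴷ_; :-_ to -ᴷ_; _:=_ to _=ᴷ_; con to conᴷ)

  pow-+ : ∀ y a b → pow y (a + b) ≡ pow y a ⊛ pow y b
  pow-+ y zero b = sym (⊛-idˡ (pow y b))
  pow-+ y (suc a) b = trans (cong (y ⊛_) (pow-+ y a b)) (sym (⊛-assoc y (pow y a) (pow y b)))

  pow-cancel : ∀ {x y} → x ⊛ y ≡ 1K → ∀ a → pow x a ⊛ pow y a ≡ 1K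
  pow-cancel xy≡1 zero = ⊛-idˡ 1K
  pow-cancel {x} {y} xy≡1 (suc a) = begin
    (x ⊛ pow x a) ⊛ (y ⊛ pow y a)   ≡⟨ solveᴷ 4 (λ x y p q → (x *ᴷ p) *ᴷ (y *ᴷ q) =ᴷ (x *ᴷ y) *ᴷ (p *ᴷ q)) refl x y (pow x a) (pow y a) ⟩
    (x ⊛ y) ⊛ (pow x a ⊛ pow y a)   ≡⟨ cong₂ _⊛_ xy≡1 (pow-cancel xy≡1 a) ⟩
    1K ⊛ 1K                         ≡⟨ ⊛-idˡ 1K ⟩
    1K                              ∎
    where open ≡-Reasoning

  qinv-inverseʳ : ∀ q → ¬ q ≡ 0ℚ → q ℚ.* qinv q ≡ 1ℚ
  qinv-inverseʳ q ne with q ℚP.≟ 0ℚ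
  ... | yes e = ⊥-elim (ne e)
  ... | no q≢0 = ℚP.*-inverseʳ q {{ℚ.≢-nonZero q≢0}}

  inv-inverseʳ : ∀ x → ¬ norm x ≡ 0ℚ → x ⊛ inv x ≡ 1K
  inv-inverseʳ (a , b) ne = cong₂ _,_ (trans (e1 a b (qinv N) mq nq) (qinv-inverseʳ N ne)) (e2 a b (qinv N) mq nq)
    where
    N = norm (a , b)
    e1 : ∀ a b w M N → a ℚ.* ((a ℚ.+ b ℚ.* M) ℚ.* w) ℚ.- N ℚ.* (b ℚ.* ((ℚ.- b) ℚ.* w))
                       ≡ (((a ℚ.* a) ℚ.+ (a ℚ.* b) ℚ.* M) ℚ.+ (b ℚ.* b) ℚ.* N) ℚ.* w
    e1 = solve 5 (λ a b w M N → a :* ((a :+ b :* M) :* w) :- N :* (b :* ((:- b) :* w))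
                       := (((a :* a) :+ (a :* b) :* M) :+ (b :* b) :* N) :* w) refl
    e2 : ∀ a b w M N → (a ℚ.* ((ℚ.- b) ℚ.* w) ℚ.+ b ℚ.* ((a ℚ.+ b ℚ.* M) ℚ.* w)) ℚ.+ M ℚ.* (b ℚ.* ((ℚ.- b) ℚ.* w)) ≡ 0ℚ
    e2 = solve 5 (λ a b w M N → (a :* ((:- b) :* w) :+ b :* ((a :+ b :* M) :* w)) :+ M :* (b :* ((:- b) :* w)) := con 0ℚ) refl

module QuadraticOrder (m n : ℕ) (0<Dq : 0< (Field.Dq m n))
    (Dq-nonsquare : ∀ P Q → P ℚ.* P ≡ (Q ℚ.* Q) ℚ.* Field.Dq m n → Q ≡ 0ℚ) where
  open QuadraticField m n public
  open SqrtOrder (Field.Dq m n) 0<Dq Dq-nonsquare public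
    using (PosPQ-add; PosPQ-mul; PosPQ-asym; ¬PosPQ-0; PosPQ-trichotomy; PosPQ-cancel-scale; PDominates⇒PosPQ; QDominates⇒PosPQ)

  2ℚ : ℚ
  2ℚ = + 2 ℚ./ 1

  Pos-add : ∀ {x y} → Pos x → Pos y → Pos (x ⊕ y)
  Pos-add {a , b} {c , d} px py = subst (λ z → PosPQ z (b ℚ.+ d)) (e a b c d mq) (PosPQ-add px py)
    where
    e : ∀ a b c d M → ((a ℚ.+ a) ℚ.+ b ℚ.* M) ℚ.+ ((c ℚ.+ c) ℚ.+ d ℚ.* M) ≡ ((a ℚ.+ c) ℚ.+ (a ℚ.+ c)) ℚ.+ (b ℚ.+ d) ℚ.* M
    e = solve 5 (λ a b c d M → ((a :+ a) :+ b :* M) :+ ((c :+ c) :+ d :* M) := ((a :+ c) :+ (a :+ c)) :+ (b :+ d) :* M) refl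

  0<2 : 0< 2ℚ
  0<2 = fromℤ-mono-< {+ 0} {+ 2} (ℤ.+<+ (ℕ.s≤s ℕ.z≤n))

  Pos-mul : ∀ {x y} → Pos x → Pos y → Pos (x ⊛ y)
  Pos-mul {a , b} {c , d} px py = PosPQ-cancel-scale 0<2 (subst₂ (PosPQ) (e1 a b c d mq nq) (e2 a b c d mq) (PosPQ-mul px py))
    where
    e1 : ∀ a b c d M N → ((a ℚ.+ a) ℚ.+ b ℚ.* M) ℚ.* ((c ℚ.+ c) ℚ.+ d ℚ.* M) ℚ.+ (b ℚ.* d) ℚ.* (M ℚ.* M ℚ.- (+ 4 ℚ./ 1) ℚ.* N)
         ≡ 2ℚ ℚ.* (((a ℚ.* c ℚ.- N ℚ.* (b ℚ.* d)) ℚ.+ (a ℚ.* c ℚ.- N ℚ.* (b ℚ.* d))) ℚ.+ ((a ℚ.* d ℚ.+ b ℚ.* c) ℚ.+ M ℚ.* (b ℚ.* d)) ℚ.* M)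
    e1 = solve 6 (λ a b c d M N → ((a :+ a) :+ b :* M) :* ((c :+ c) :+ d :* M) :+ (b :* d) :* (M :* M :- con (+ 4 ℚ./ 1) :* N)
         := con 2ℚ :* (((a :* c :- N :* (b :* d)) :+ (a :* c :- N :* (b :* d))) :+ ((a :* d :+ b :* c) :+ M :* (b :* d)) :* M)) refl
    e2 : ∀ a b c d M → ((a ℚ.+ a) ℚ.+ b ℚ.* M) ℚ.* d ℚ.+ ((c ℚ.+ c) ℚ.+ d ℚ.* M) ℚ.* b
         ≡ 2ℚ ℚ.* ((a ℚ.* d ℚ.+ b ℚ.* c) ℚ.+ M ℚ.* (b ℚ.* d))
    e2 = solve 5 (λ a b c d M → ((a :+ a) :+ b :* M) :* d :+ ((c :+ c) :+ d :* M) :* b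
         := con 2ℚ :* ((a :* d :+ b :* c) :+ M :* (b :* d))) refl

  Pos-asym : ∀ {x} → Pos x → Pos (⊖ x) → ⊥
  Pos-asym {a , b} px pn = PosPQ-asym px (subst (λ z → PosPQ z (ℚ.- b)) (e a b mq) pn)
    where
    e : ∀ a b M → ((ℚ.- a) ℚ.+ (ℚ.- a)) ℚ.+ (ℚ.- b) ℚ.* M ≡ ℚ.- ((a ℚ.+ a) ℚ.+ b ℚ.* M)
    e = solve 3 (λ a b M → ((:- a) :+ (:- a)) :+ (:- b) :* M := :- ((a :+ a) :+ b :* M)) refl

  ¬Pos-0K : ¬ Pos 0K
  ¬Pos-0K p = ¬PosPQ-0 (subst (λ z → PosPQ z 0ℚ) (e mq) p)
    where
    e : ∀ M → (0ℚ ℚ.+ 0ℚ) ℚ.+ 0ℚ ℚ.* M ≡ 0ℚ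
    e = solve 1 (λ M → (con 0ℚ :+ con 0ℚ) :+ con 0ℚ :* M := con 0ℚ) refl

  Pos-trichotomy : ∀ x → Pos x ⊎ (x ≡ 0K) ⊎ Pos (⊖ x)
  Pos-trichotomy (a , b) with PosPQ-trichotomy ((a ℚ.+ a) ℚ.+ b ℚ.* mq) b
  ... | inj₁ p = inj₁ p
  ... | inj₂ (inj₂ p) = inj₂ (inj₂ (subst (λ z → PosPQ z (ℚ.- b)) (e a b mq) p))
    where
    e : ∀ a b M → ℚ.- ((a ℚ.+ a) ℚ.+ b ℚ.* M) ≡ ((ℚ.- a) ℚ.+ (ℚ.- a)) ℚ.+ (ℚ.- b) ℚ.* M
    e = solve 3 (λ a b M → :- ((a :+ a) :+ b :* M) := ((:- a) :+ (:- a)) :+ (:- b) :* M) refl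
  ... | inj₂ (inj₁ (pz , bz)) = inj₂ (inj₁ (cong₂ _,_ az bz))
    where
    e : ∀ a b M → a ≡ (+ 1 ℚ./ 2) ℚ.* (((a ℚ.+ a) ℚ.+ b ℚ.* M) ℚ.- b ℚ.* M)
    e = solve 3 (λ a b M → a := con (+ 1 ℚ./ 2) :* (((a :+ a) :+ b :* M) :- b :* M)) refl
    az : a ≡ 0ℚ
    az = trans (e a b mq) (trans (cong (λ z → (+ 1 ℚ./ 2) ℚ.* (z ℚ.- b ℚ.* mq)) pz)
           (trans (cong (λ z → (+ 1 ℚ./ 2) ℚ.* (0ℚ ℚ.- z ℚ.* mq)) bz) (e2 mq)))
      where
      e2 : ∀ M → (+ 1 ℚ./ 2) ℚ.* (0ℚ ℚ.- 0ℚ ℚ.* M) ≡ 0ℚ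
      e2 = solve 1 (λ M → con (+ 1 ℚ./ 2) :* (con 0ℚ :- con 0ℚ :* M) := con 0ℚ) refl

  NonNeg : K → Set
  NonNeg x = Pos x ⊎ x ≡ 0K

  Pos-≡ : ∀ {x y} → Pos x → x ≡ y → Pos y
  Pos-≡ p refl = p

  NonNeg-≡ : ∀ {x y} → NonNeg x → x ≡ y → NonNeg y
  NonNeg-≡ p refl = p

  Pos-+-NonNeg : ∀ {x y} → Pos x → NonNeg y → Pos (x ⊕ y)
  Pos-+-NonNeg {x} {y} px (inj₁ py) = Pos-add {x} {y} px py
  Pos-+-NonNeg {x} px (inj₂ refl) = Pos-≡ px (sym (solveᴷ 1 (λ x → x +ᴷ conᴷ (+ 0) =ᴷ x) refl x))

  NonNeg-+ : ∀ {x y} → NonNeg x → NonNeg y → NonNeg (x ⊕ y)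
  NonNeg-+ {x} {y} (inj₁ px) ny = inj₁ (Pos-+-NonNeg {x} {y} px ny)
  NonNeg-+ {x} {y} (inj₂ refl) ny = NonNeg-≡ ny (solveᴷ 1 (λ y → y =ᴷ conᴷ (+ 0) +ᴷ y) refl y)

  Pos-*-NonNeg : ∀ {a x} → Pos a → NonNeg x → NonNeg (a ⊛ x)
  Pos-*-NonNeg {a} {x} pa (inj₁ px) = inj₁ (Pos-mul {a} {x} pa px)
  Pos-*-NonNeg {a} {x} pa (inj₂ refl) = inj₂ (solveᴷ 1 (λ a → a *ᴷ conᴷ (+ 0) =ᴷ conᴷ (+ 0)) refl a)

  ⊖-⊝ : ∀ x y → ⊖ (y ⊝ x) ≡ x ⊝ y
  ⊖-⊝ = solveᴷ 2 (λ x y → -ᴷ (y -ᴷ x) =ᴷ x -ᴷ y) refl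

  Pos∧NonNeg-⊖⇒⊥ : ∀ {x} → Pos x → NonNeg (⊖ x) → ⊥
  Pos∧NonNeg-⊖⇒⊥ {x} px (inj₁ p) = Pos-asym {x} px p
  Pos∧NonNeg-⊖⇒⊥ {x} px (inj₂ z) = ¬Pos-0K (Pos-≡ px (trans (solveᴷ 1 (λ x → x =ᴷ -ᴷ (-ᴷ x)) refl x) (cong ⊖_ z)))

  ≼⇒NonNeg : ∀ {x y} → x ≼ y → NonNeg (y ⊝ x)
  ≼⇒NonNeg {x} {y} x≼y = [ inj₁ , [ inj₂ , (λ p → ⊥-elim (x≼y (Pos-≡ p (⊖-⊝ x y)))) ]′ ]′ (Pos-trichotomy (y ⊝ x))

  ≈⇒≡ : ∀ {x y} → x ≈ y → x ≡ y
  ≈⇒≡ {x} {y} (x≼y , y≼x) =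
    [ (λ p → ⊥-elim (x≼y p)) , [ x⊝y≡0⇒x≡y , (λ p → ⊥-elim (y≼x (Pos-≡ p (⊖-⊝ y x)))) ]′ ]′ (Pos-trichotomy (x ⊝ y))
    where
    x⊝y≡0⇒x≡y : x ⊝ y ≡ 0K → x ≡ y
    x⊝y≡0⇒x≡y z = begin
      x              ≡⟨ solveᴷ 2 (λ x y → x =ᴷ (x -ᴷ y) +ᴷ y) refl x y ⟩
      (x ⊝ y) ⊕ y    ≡⟨ cong (_⊕ y) z ⟩
      0K ⊕ y         ≡⟨ solveᴷ 1 (λ y → conᴷ (+ 0) +ᴷ y =ᴷ y) refl y ⟩
      y              ∎
      where open ≡-Reasoning

  ≡⇒≈ : ∀ {x y} → x ≡ y → x ≈ y
  ≡⇒≈ {x} refl = x≼x , x≼x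
    where
    x≼x : x ≼ x
    x≼x p = ¬Pos-0K (Pos-≡ p (solveᴷ 1 (λ x → x -ᴷ x =ᴷ conᴷ (+ 0)) refl x))

  Pos-pair : ∀ {x a b} → x ≡ (a , b) → PosPQ ((a ℚ.+ a) ℚ.+ b ℚ.* mq) b → Pos x
  Pos-pair refl p = p

  Pos-rational : ∀ {x} p → x ≡ (p , 0ℚ) → 0< p → Pos x
  Pos-rational {x} p e 0<p = Pos-pair {x} {p} {0ℚ} e (inj₁ (0<⇒0≤ 0<2p , ℚP.≤-refl , inj₁ 0<2p))
    where
    e′ : ∀ p M → p ℚ.+ p ≡ (p ℚ.+ p) ℚ.+ 0ℚ ℚ.* M
    e′ = solve 2 (λ p M → p :+ p := (p :+ p) :+ con 0ℚ :* M) refl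
    0<2p : 0< ((p ℚ.+ p) ℚ.+ 0ℚ ℚ.* mq)
    0<2p = 0<-≡ (0<-+ 0<p 0<p) (e′ p mq)

  NonNeg-rational : ∀ {x} p → x ≡ (p , 0ℚ) → 0≤ p → NonNeg x
  NonNeg-rational {x} p e 0≤p =
    [ (λ 0<p → inj₁ (Pos-rational p e 0<p)) , [ (λ p≡0 → inj₂ (trans e (cong (_, 0ℚ) p≡0))) , (λ 0<-p → ⊥-elim (0≤∧0<-neg⇒⊥ 0≤p 0<-p)) ]′ ]′
      (0<-trichotomy p)

  ι-⊝ : ∀ a b → ι a ⊝ ι b ≡ (fromℤ a ℚ.- fromℤ b , 0ℚ)
  ι-⊝ a b = cong (fromℤ a ℚ.- fromℤ b ,_) (ℚP.+-inverseʳ 0ℚ)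

  NonNeg-ι-⊝ : ∀ {a b} → b ℤ.≤ a → NonNeg (ι a ⊝ ι b)
  NonNeg-ι-⊝ {a} {b} h = NonNeg-rational _ (ι-⊝ a b) (≤⇒0≤-diff (fromℤ-mono-≤ h))

  Pos-ι-⊝ : ∀ {a b} → b ℤ.< a → Pos (ι a ⊝ ι b)
  Pos-ι-⊝ {a} {b} h = Pos-rational _ (ι-⊝ a b) (<⇒0<-diff (fromℤ-mono-< h))

  ¬Pos-ι-⊝ : ∀ {a b} → a ℤ.≤ b → ¬ Pos (ι a ⊝ ι b)
  ¬Pos-ι-⊝ {a} {b} a≤b p = Pos∧NonNeg-⊖⇒⊥ {ι a ⊝ ι b} p (NonNeg-≡ {ι b ⊝ ι a} {⊖ (ι a ⊝ ι b)} (NonNeg-ι-⊝ a≤b) (sym (⊖-⊝ (ι b) (ι a))))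

  ⊝-ι0 : ∀ x → x ⊝ ι (+ 0) ≡ x
  ⊝-ι0 = solveᴷ 1 (λ x → x -ᴷ conᴷ (+ 0) =ᴷ x) refl

  NonNeg-ι : ∀ {a} → + 0 ℤ.≤ a → NonNeg (ι a)
  NonNeg-ι {a} h = NonNeg-≡ {ι a ⊝ ι (+ 0)} (NonNeg-ι-⊝ h) (⊝-ι0 (ι a))

  ¬Pos-ι : ∀ {a} → a ℤ.≤ + 0 → ¬ Pos (ι a)
  ¬Pos-ι {a} h p = ¬Pos-ι-⊝ h (Pos-≡ p (sym (⊝-ι0 (ι a))))

  0<1 : 0< 1ℚ
  0<1 = fromℤ-mono-< {+ 0} {+ 1} (ℤ.+<+ (ℕ.s≤s ℕ.z≤n))

  Pos-1 : Pos 1K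
  Pos-1 = Pos-rational {1K} 1ℚ refl 0<1

  Pos-inverse : ∀ {x y} → Pos x → x ⊛ y ≡ 1K → Pos y
  Pos-inverse {x} {y} px xy≡1 = [ (λ py → py) , [ y≡0⇒ , y<0⇒ ]′ ]′ (Pos-trichotomy y)
    where
    y≡0⇒ : y ≡ 0K → Pos y
    y≡0⇒ y≡0 = ⊥-elim (¬Pos-0K (Pos-≡ {1K} {0K} Pos-1 (begin
      1K       ≡⟨ sym xy≡1 ⟩
      x ⊛ y    ≡⟨ cong (x ⊛_) y≡0 ⟩
      x ⊛ 0K   ≡⟨ solveᴷ 1 (λ x → x *ᴷ conᴷ (+ 0) =ᴷ conᴷ (+ 0)) refl x ⟩
      0K       ∎)))
      where open ≡-Reasoning
    y<0⇒ : Pos (⊖ y) → Pos y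
    y<0⇒ p = ⊥-elim (Pos-asym {1K} Pos-1 (Pos-≡ {x ⊛ (⊖ y)} {⊖ 1K} (Pos-mul {x} {⊖ y} px p)
      (trans (solveᴷ 2 (λ x y → x *ᴷ (-ᴷ y) =ᴷ -ᴷ (x *ᴷ y)) refl x y) (cong ⊖_ xy≡1))))

module Leading (x : ℤ → ℤ) where

  lead : ℕ → ℕ
  lead zero = zero
  lead (suc k) with x (+ k) ℤ.≟ + 0
  ... | yes _ = lead k
  ... | no _ = suc k

  lead≤ : ∀ k → lead k ≤ k
  lead≤ zero = ℕ.z≤n
  lead≤ (suc k) with x (+ k) ℤ.≟ + 0
  ... | yes _ = ℕP.m≤n⇒m≤1+n (lead≤ k)
  ... | no _ = ℕP.≤-refl

  <1+⇒≤ : ∀ {p k} → p ℤ.< + suc k → p ℤ.≤ + k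
  <1+⇒≤ (ℤ.+<+ (ℕ.s≤s h)) = ℤ.+≤+ h
  <1+⇒≤ ℤ.-<+ = ℤ.-≤+

  lead-vanishes : ∀ k p → + lead k ℤ.≤ p → p ℤ.< + k → x p ≡ + 0
  lead-vanishes zero p lead≤p p<k = ⊥-elim (ℤP.<-irrefl refl (ℤP.≤-<-trans lead≤p p<k))
  lead-vanishes (suc k) p lead≤p p<k with x (+ k) ℤ.≟ + 0
  ... | no _ = ⊥-elim (ℤP.<-irrefl refl (ℤP.≤-<-trans lead≤p p<k))
  ... | yes xₖ≡0 with p ℤ.≟ + k
  ...   | yes refl = xₖ≡0
  ...   | no p≢k = lead-vanishes k p lead≤p (ℤP.≤∧≢⇒< (<1+⇒≤ p<k) p≢k)

  lead-nonzero : ∀ k → lead k ≡ 0 ⊎ Σ ℕ λ j → (lead k ≡ suc j) × (x (+ j) ≢ + 0)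
  lead-nonzero zero = inj₁ refl
  lead-nonzero (suc k) with x (+ k) ℤ.≟ + 0
  ... | yes _ = lead-nonzero k
  ... | no xₖ≢0 = inj₂ (k , refl , xₖ≢0)

m∸n≡1+[m∸1+n] : ∀ {m n} → n ℕ.< m → m ∸ n ≡ suc (m ∸ suc n)
m∸n≡1+[m∸1+n] {suc m} {zero} _ = refl
m∸n≡1+[m∸1+n] {suc m} {suc n} (ℕ.s≤s n<m) = m∸n≡1+[m∸1+n] n<m

module Expansion (m n : ℕ) (1≤n : 1 ≤ n) (n+2≤m : n + 2 ≤ m) where
  open Discriminant m n 1≤n n+2≤m using (0<Dq; Dq-nonsquare)
  open QuadraticOrder m n 0<Dq Dq-nonsquare public
  open ≡-Reasoning

  γ r l : K
  γ = inv -βK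
  r = inv (β ⊕ ι (+ 1))
  l = ⊖ c

  0<n : 0< nq
  0<n = fromℤ-mono-< {+ 0} {+ n} (ℤ.+<+ 1≤n)

  1≤m : 1 ≤ m
  1≤m = ℕP.≤-trans (ℕP.≤-trans (ℕ.s≤s ℕ.z≤n) (ℕP.m≤n+m 2 n)) n+2≤m

  0<m : 0< mq
  0<m = fromℤ-mono-< {+ 0} {+ m} (ℤ.+<+ 1≤m)

  0<4 : 0< (+ 4 ℚ./ 1)
  0<4 = fromℤ-mono-< {+ 0} {+ 4} (ℤ.+<+ (ℕ.s≤s ℕ.z≤n))

  0<m-[n+1] : 0< (mq ℚ.- (nq ℚ.+ 1ℚ))
  0<m-[n+1] = subst (λ z → 0< (mq ℚ.- z)) (trans (cong fromℤ (ℤP.pos-+ n 1)) (fromℤ-+ (+ n) (+ 1)))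
           (<⇒0<-diff (fromℤ-mono-< {+ (n + 1)} {+ m} (ℤ.+<+ (ℕP.≤-trans (ℕP.≤-reflexive (sym (ℕP.+-suc n 1))) n+2≤m))))

  0<⇒≢0 : ∀ {q} → 0< q → q ≢ 0ℚ
  0<⇒≢0 p e = 0≮0 (subst 0<_ e p)

  -β⊛γ≡1 : -βK ⊛ γ ≡ 1K
  -β⊛γ≡1 = inv-inverseʳ -βK (λ e → 0<⇒≢0 0<n (trans (sym (norm[-β]≡n mq nq)) e))
    where
    norm[-β]≡n : ∀ M N → (((ℚ.- 0ℚ) ℚ.* (ℚ.- 0ℚ)) ℚ.+ ((ℚ.- 0ℚ) ℚ.* (ℚ.- 1ℚ)) ℚ.* M) ℚ.+ ((ℚ.- 1ℚ) ℚ.* (ℚ.- 1ℚ)) ℚ.* N ≡ N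
    norm[-β]≡n = solve 2 (λ M N → (((:- con 0ℚ) :* (:- con 0ℚ)) :+ ((:- con 0ℚ) :* (:- con 1ℚ)) :* M) :+ ((:- con 1ℚ) :* (:- con 1ℚ)) :* N := N) refl

  [β+1]⊛r≡1 : (β ⊕ 1K) ⊛ r ≡ 1K
  [β+1]⊛r≡1 = inv-inverseʳ (β ⊕ 1K) (λ e → 0<⇒≢0 0<1+m+n (trans (sym (norm[β+1]≡1+m+n mq nq)) e))
    where
    norm[β+1]≡1+m+n : ∀ M N → (((0ℚ ℚ.+ 1ℚ) ℚ.* (0ℚ ℚ.+ 1ℚ)) ℚ.+ ((0ℚ ℚ.+ 1ℚ) ℚ.* (1ℚ ℚ.+ 0ℚ)) ℚ.* M)
        ℚ.+ ((1ℚ ℚ.+ 0ℚ) ℚ.* (1ℚ ℚ.+ 0ℚ)) ℚ.* N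
        ≡ (1ℚ ℚ.+ M) ℚ.+ N
    norm[β+1]≡1+m+n = solve 2 (λ M N → (((con 0ℚ :+ con 1ℚ) :* (con 0ℚ :+ con 1ℚ)) :+ ((con 0ℚ :+ con 1ℚ) :* (con 1ℚ :+ con 0ℚ)) :* M)
        :+ ((con 1ℚ :+ con 0ℚ) :* (con 1ℚ :+ con 0ℚ)) :* N
        := (con 1ℚ :+ M) :+ N) refl
    0<1+m+n : 0< ((1ℚ ℚ.+ mq) ℚ.+ nq)
    0<1+m+n = 0<-+ (0<-+ 0<1 0<m) 0<n

  β²≡mβ-n : β ⊛ β ≡ (ι (+ m) ⊛ β) ⊝ ι (+ n)
  β²≡mβ-n = cong₂ _,_ (e1 mq nq) (e2 mq nq)
    where
    e1 : ∀ M N → 0ℚ ℚ.* 0ℚ ℚ.- N ℚ.* (1ℚ ℚ.* 1ℚ) ≡ (M ℚ.* 0ℚ ℚ.- N ℚ.* (0ℚ ℚ.* 1ℚ)) ℚ.+ (ℚ.- N)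
    e1 = solve 2 (λ M N → con 0ℚ :* con 0ℚ :- N :* (con 1ℚ :* con 1ℚ) := (M :* con 0ℚ :- N :* (con 0ℚ :* con 1ℚ)) :+ (:- N)) refl
    e2 : ∀ M N → (0ℚ ℚ.* 1ℚ ℚ.+ 1ℚ ℚ.* 0ℚ) ℚ.+ M ℚ.* (1ℚ ℚ.* 1ℚ) ≡ ((M ℚ.* 1ℚ ℚ.+ 0ℚ ℚ.* 0ℚ) ℚ.+ M ℚ.* (0ℚ ℚ.* 1ℚ)) ℚ.+ (ℚ.- 0ℚ)
    e2 = solve 2 (λ M N → (con 0ℚ :* con 1ℚ :+ con 1ℚ :* con 0ℚ) :+ M :* (con 1ℚ :* con 1ℚ)
        := ((M :* con 1ℚ :+ con 0ℚ :* con 0ℚ) :+ M :* (con 0ℚ :* con 1ℚ)) :+ (:- con 0ℚ)) refl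

  Pos-β : Pos β
  Pos-β = Pos-pair {β} {0ℚ} {1ℚ} refl (inj₁ (0<⇒0≤ (0<-≡ 0<m (e mq)) , 0<⇒0≤ 0<1 , inj₂ 0<1))
    where
    e : ∀ M → M ≡ (0ℚ ℚ.+ 0ℚ) ℚ.+ 1ℚ ℚ.* M
    e = solve 1 (λ M → M := (con 0ℚ :+ con 0ℚ) :+ con 1ℚ :* M) refl

  -- With f = x² - m x + n: f(m-1) = n + 1 - m < 0, so m - 1 lies between the roots of f.
  m-1≺β : Pos (β ⊝ (ι (+ m) ⊝ 1K))
  m-1≺β = Pos-pair {β ⊝ (ι (+ m) ⊝ 1K)} {1ℚ ℚ.- mq} {1ℚ} (cong₂ _,_ (e0 mq) (e1 mq))
           (QDominates⇒PosPQ (0<1 , 0<-≡ (0<-* 0<4 0<m-[n+1]) (e2 mq nq)))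
    where
    e0 : ∀ M → 0ℚ ℚ.+ ℚ.- (M ℚ.+ ℚ.- 1ℚ) ≡ 1ℚ ℚ.- M
    e0 = solve 1 (λ M → con 0ℚ :+ :- (M :+ :- con 1ℚ) := con 1ℚ :- M) refl
    e1 : ∀ M → 1ℚ ℚ.+ ℚ.- (0ℚ ℚ.+ ℚ.- 0ℚ) ≡ 1ℚ
    e1 = solve 1 (λ M → con 1ℚ :+ :- (con 0ℚ :+ :- con 0ℚ) := con 1ℚ) refl
    e2 : ∀ M N → (+ 4 ℚ./ 1) ℚ.* (M ℚ.- (N ℚ.+ 1ℚ))
         ≡ (1ℚ ℚ.* 1ℚ) ℚ.* (M ℚ.* M ℚ.- (+ 4 ℚ./ 1) ℚ.* N)
             ℚ.- ((1ℚ ℚ.- M) ℚ.+ (1ℚ ℚ.- M) ℚ.+ 1ℚ ℚ.* M) ℚ.* ((1ℚ ℚ.- M) ℚ.+ (1ℚ ℚ.- M) ℚ.+ 1ℚ ℚ.* M)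
    e2 = solve 2 (λ M N → con (+ 4 ℚ./ 1) :* (M :- (N :+ con 1ℚ))
         := (con 1ℚ :* con 1ℚ) :* (M :* M :- con (+ 4 ℚ./ 1) :* N) :- ((con 1ℚ :- M) :+ (con 1ℚ :- M) :+ con 1ℚ :* M) :* ((con 1ℚ :- M) :+ (con 1ℚ :- M) :+ con 1ℚ :* M)) refl

  β≺m : Pos (ι (+ m) ⊝ β)
  β≺m = Pos-pair {ι (+ m) ⊝ β} {mq} {ℚ.- 1ℚ} (cong₂ _,_ (e0 mq) (e1 mq))
           (PDominates⇒PosPQ (0<-≡ 0<m (e2 mq) , 0<-≡ (0<-* 0<4 0<n) (e3 mq nq)))
    where
    e0 : ∀ M → M ℚ.+ ℚ.- 0ℚ ≡ M
    e0 = solve 1 (λ M → M :+ :- con 0ℚ := M) refl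
    e1 : ∀ M → 0ℚ ℚ.+ ℚ.- 1ℚ ≡ ℚ.- 1ℚ
    e1 = solve 1 (λ M → con 0ℚ :+ :- con 1ℚ := :- con 1ℚ) refl
    e2 : ∀ M → M ≡ (M ℚ.+ M) ℚ.+ (ℚ.- 1ℚ) ℚ.* M
    e2 = solve 1 (λ M → M := (M :+ M) :+ (:- con 1ℚ) :* M) refl
    e3 : ∀ M N → (+ 4 ℚ./ 1) ℚ.* N
         ≡ ((M ℚ.+ M) ℚ.+ (ℚ.- 1ℚ) ℚ.* M) ℚ.* ((M ℚ.+ M) ℚ.+ (ℚ.- 1ℚ) ℚ.* M) ℚ.- ((ℚ.- 1ℚ) ℚ.* (ℚ.- 1ℚ)) ℚ.* (M ℚ.* M ℚ.- (+ 4 ℚ./ 1) ℚ.* N)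
    e3 = solve 2 (λ M N → con (+ 4 ℚ./ 1) :* N
         := ((M :+ M) :+ (:- con 1ℚ) :* M) :* ((M :+ M) :+ (:- con 1ℚ) :* M) :- ((:- con 1ℚ) :* (:- con 1ℚ)) :* (M :* M :- con (+ 4 ℚ./ 1) :* N)) refl

  ι[m∸1] : ι (+ (m ∸ 1)) ≡ ι (+ m) ⊝ 1K
  ι[m∸1] = trans (cong ι (sym (trans (ℤP.m-n≡m⊖n m 1) (ℤP.⊖-≥ 1≤m)))) (trans (ι-+ (+ m) (ℤ.- (+ 1))) (cong (ι (+ m) ⊕_) (ι-neg (+ 1))))

  m∸1≺β : Pos (β ⊝ ι (+ (m ∸ 1)))
  m∸1≺β = Pos-≡ m-1≺β (cong (β ⊝_) (sym ι[m∸1]))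

  1≺β : Pos (β ⊝ 1K)
  1≺β = Pos-≡ (Pos-add {β ⊝ (ι (+ m) ⊝ 1K)} {ι (+ m) ⊝ ι (+ 2)} m-1≺β (Pos-ι-⊝ (ℤ.+<+ 2<m)))
          (solveᴷ 2 (λ b M → (b -ᴷ (M -ᴷ conᴷ (+ 1))) +ᴷ (M -ᴷ conᴷ (+ 2)) =ᴷ b -ᴷ conᴷ (+ 1)) refl β (ι (+ m)))
    where
    2<m : 2 ℕ.< m
    2<m = ℕP.≤-trans (ℕP.≤-reflexive (ℕP.+-comm 3 0)) (ℕP.≤-trans (ℕP.+-monoˡ-≤ 2 1≤n) n+2≤m)

  Pos-r : Pos r
  Pos-r = Pos-inverse {β ⊕ 1K} {r} (Pos-add {β} {1K} Pos-β Pos-1) [β+1]⊛r≡1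

  Pos-c : Pos c
  Pos-c = Pos-mul {β} {r} Pos-β Pos-r

  Pos-⊖γ : Pos (⊖ γ)
  Pos-⊖γ = Pos-inverse {β} {⊖ γ} Pos-β (trans (solveᴷ 2 (λ b g → b *ᴷ (-ᴷ g) =ᴷ (-ᴷ b) *ᴷ g) refl β γ) -β⊛γ≡1)

  c≡1-r : c ≡ 1K ⊝ r
  c≡1-r = begin
      c                          ≡⟨ solveᴷ 2 (λ b r → b *ᴷ r =ᴷ ((b +ᴷ conᴷ (+ 1)) *ᴷ r) -ᴷ r) refl β r ⟩
      ((β ⊕ 1K) ⊛ r) ⊝ r         ≡⟨ cong (_⊝ r) [β+1]⊛r≡1 ⟩
      1K ⊝ r                     ∎

  c⊕r≡1 : c ⊕ r ≡ 1K
  c⊕r≡1 = trans (cong (_⊕ r) c≡1-r) (solveᴷ 1 (λ r → (conᴷ (+ 1) -ᴷ r) +ᴷ r =ᴷ conᴷ (+ 1)) refl r)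

  β⊛c≡β-c : β ⊛ c ≡ β ⊝ c
  β⊛c≡β-c = begin
      β ⊛ c                      ≡⟨ solveᴷ 2 (λ b r → b *ᴷ (b *ᴷ r) =ᴷ (b *ᴷ ((b +ᴷ conᴷ (+ 1)) *ᴷ r)) -ᴷ (b *ᴷ r)) refl β r ⟩
      (β ⊛ ((β ⊕ 1K) ⊛ r)) ⊝ c   ≡⟨ cong (λ z → (β ⊛ z) ⊝ c) [β+1]⊛r≡1 ⟩
      (β ⊛ 1K) ⊝ c               ≡⟨ cong (_⊝ c) (⊛-idʳ β) ⟩
      β ⊝ c                      ∎

  -β⊛l≡β-c : -βK ⊛ l ≡ β ⊝ c
  -β⊛l≡β-c = trans (solveᴷ 2 (λ b c → (-ᴷ b) *ᴷ (-ᴷ c) =ᴷ b *ᴷ c) refl β c) β⊛c≡β-c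

  -β⊛l≡β+r-1 : -βK ⊛ l ≡ (β ⊕ r) ⊝ 1K
  -β⊛l≡β+r-1 = begin
      -βK ⊛ l        ≡⟨ -β⊛l≡β-c ⟩
      β ⊝ c          ≡⟨ cong (β ⊝_) c≡1-r ⟩
      β ⊝ (1K ⊝ r)   ≡⟨ solveᴷ 2 (λ b r → b -ᴷ (conᴷ (+ 1) -ᴷ r) =ᴷ (b +ᴷ r) -ᴷ conᴷ (+ 1)) refl β r ⟩
      (β ⊕ r) ⊝ 1K   ∎

  γ-cancelˡ : ∀ x → γ ⊛ (-βK ⊛ x) ≡ x
  γ-cancelˡ x = begin
      γ ⊛ (-βK ⊛ x)  ≡⟨ solveᴷ 3 (λ g b x → g *ᴷ ((-ᴷ b) *ᴷ x) =ᴷ ((-ᴷ b) *ᴷ g) *ᴷ x) refl γ β x ⟩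
      (-βK ⊛ γ) ⊛ x  ≡⟨ cong (_⊛ x) -β⊛γ≡1 ⟩
      1K ⊛ x         ≡⟨ ⊛-idˡ x ⟩
      x              ∎

  γ-cancelʳ : ∀ x → -βK ⊛ (γ ⊛ x) ≡ x
  γ-cancelʳ x = trans (solveᴷ 3 (λ g b x → (-ᴷ b) *ᴷ (g *ᴷ x) =ᴷ g *ᴷ ((-ᴷ b) *ᴷ x)) refl γ β x) (γ-cancelˡ x)

  β-[-βt+c]≡β[t-l] : ∀ t → β ⊝ ((-βK ⊛ t) ⊕ c) ≡ β ⊛ (t ⊝ l)
  β-[-βt+c]≡β[t-l] t = begin
      β ⊝ ((-βK ⊛ t) ⊕ c)  ≡⟨ solveᴷ 3 (λ b c t → b -ᴷ (((-ᴷ b) *ᴷ t) +ᴷ c) =ᴷ (b *ᴷ t) +ᴷ (b -ᴷ c)) refl β c t ⟩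
      (β ⊛ t) ⊕ (β ⊝ c)    ≡⟨ cong ((β ⊛ t) ⊕_) (sym β⊛c≡β-c) ⟩
      (β ⊛ t) ⊕ (β ⊛ c)    ≡⟨ solveᴷ 3 (λ b c t → (b *ᴷ t) +ᴷ (b *ᴷ c) =ᴷ b *ᴷ (t -ᴷ (-ᴷ c))) refl β c t ⟩
      β ⊛ (t ⊝ l)          ∎

  -βw-r≡β[l-w]+β-1 : ∀ w → (-βK ⊛ w) ⊝ r ≡ (β ⊛ (l ⊝ w)) ⊕ (β ⊝ 1K)
  -βw-r≡β[l-w]+β-1 w = sym (begin
      (β ⊛ (l ⊝ w)) ⊕ (β ⊝ 1K)
          ≡⟨ solveᴷ 3 (λ b c w → (b *ᴷ ((-ᴷ c) -ᴷ w)) +ᴷ (b -ᴷ conᴷ (+ 1))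
                 =ᴷ ((-ᴷ (b *ᴷ c)) -ᴷ (b *ᴷ w)) +ᴷ (b -ᴷ conᴷ (+ 1))) refl β c w ⟩
      ((⊖ (β ⊛ c)) ⊝ (β ⊛ w)) ⊕ (β ⊝ 1K)
          ≡⟨ cong (λ u → ((⊖ u) ⊝ (β ⊛ w)) ⊕ (β ⊝ 1K)) (trans β⊛c≡β-c (cong (β ⊝_) c≡1-r)) ⟩
      ((⊖ (β ⊝ (1K ⊝ r))) ⊝ (β ⊛ w)) ⊕ (β ⊝ 1K)
          ≡⟨ solveᴷ 3 (λ b r w → ((-ᴷ (b -ᴷ (conᴷ (+ 1) -ᴷ r))) -ᴷ (b *ᴷ w)) +ᴷ (b -ᴷ conᴷ (+ 1))
                 =ᴷ ((-ᴷ b) *ᴷ w) -ᴷ r) refl β r w ⟩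
      (-βK ⊛ w) ⊝ r ∎)

  -- A tail lies below B whenever its leading digit is at least n; this is what lets a digit m - 1 precede it.
  B : K
  B = (-βK ⊛ l) ⊝ ι (+ (m ∸ 1))

  -β⊛B≡n+l : -βK ⊛ B ≡ ι (+ n) ⊕ l
  -β⊛B≡n+l = begin
      -βK ⊛ B
          ≡⟨ cong₂ (λ u v → -βK ⊛ (u ⊝ v)) -β⊛l≡β-c ι[m∸1] ⟩
      -βK ⊛ ((β ⊝ c) ⊝ (ι (+ m) ⊝ 1K))
          ≡⟨ solveᴷ 3 (λ b c M → (-ᴷ b) *ᴷ ((b -ᴷ c) -ᴷ (M -ᴷ conᴷ (+ 1)))
                 =ᴷ ((M *ᴷ b) -ᴷ (b *ᴷ b)) +ᴷ (b *ᴷ c) -ᴷ b) refl β c (ι (+ m)) ⟩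
      (((ι (+ m) ⊛ β) ⊝ (β ⊛ β)) ⊕ (β ⊛ c)) ⊝ β
          ≡⟨ cong₂ (λ u v → (((ι (+ m) ⊛ β) ⊝ u) ⊕ v) ⊝ β) β²≡mβ-n β⊛c≡β-c ⟩
      (((ι (+ m) ⊛ β) ⊝ ((ι (+ m) ⊛ β) ⊝ ι (+ n))) ⊕ (β ⊝ c)) ⊝ β
          ≡⟨ solveᴷ 4 (λ b c M N → (((M *ᴷ b) -ᴷ ((M *ᴷ b) -ᴷ N)) +ᴷ (b -ᴷ c)) -ᴷ b
                 =ᴷ N +ᴷ (-ᴷ c)) refl β c (ι (+ m)) (ι (+ n)) ⟩
      ι (+ n) ⊕ l ∎

  -- After the digit m - 1, the next point -β t' + c exceeds n by β²(t - l) ≥ 0.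
  -β[-βt-[m-1]]+c-n≡β²[t-l] : ∀ t → ((-βK ⊛ ((-βK ⊛ t) ⊝ ι (+ (m ∸ 1)))) ⊕ c) ⊝ ι (+ n) ≡ β ⊛ (β ⊛ (t ⊝ l))
  -β[-βt-[m-1]]+c-n≡β²[t-l] t = trans lhs (sym rhs)
    where
    normal-form : K
    normal-form = ((β ⊛ β) ⊛ t) ⊕ (((ι (+ m) ⊛ β) ⊝ ι (+ n)) ⊝ (β ⊝ c))
    lhs : ((-βK ⊛ ((-βK ⊛ t) ⊝ ι (+ (m ∸ 1)))) ⊕ c) ⊝ ι (+ n) ≡ normal-form
    lhs = begin
      ((-βK ⊛ ((-βK ⊛ t) ⊝ ι (+ (m ∸ 1)))) ⊕ c) ⊝ ι (+ n)
          ≡⟨ cong (λ u → ((-βK ⊛ ((-βK ⊛ t) ⊝ u)) ⊕ c) ⊝ ι (+ n)) ι[m∸1] ⟩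
      ((-βK ⊛ ((-βK ⊛ t) ⊝ (ι (+ m) ⊝ 1K))) ⊕ c) ⊝ ι (+ n)
          ≡⟨ solveᴷ 5 (λ b c M N t → (((-ᴷ b) *ᴷ (((-ᴷ b) *ᴷ t) -ᴷ (M -ᴷ conᴷ (+ 1)))) +ᴷ c) -ᴷ N
                 =ᴷ ((b *ᴷ b) *ᴷ t) +ᴷ (((M *ᴷ b) -ᴷ N) -ᴷ (b -ᴷ c))) refl β c (ι (+ m)) (ι (+ n)) t ⟩
      normal-form ∎
    rhs : β ⊛ (β ⊛ (t ⊝ l)) ≡ normal-form
    rhs = begin
      β ⊛ (β ⊛ (t ⊝ l))
          ≡⟨ solveᴷ 3 (λ b c t → b *ᴷ (b *ᴷ (t -ᴷ (-ᴷ c))) =ᴷ ((b *ᴷ b) *ᴷ t) +ᴷ (b *ᴷ (b *ᴷ c))) refl β c t ⟩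
      ((β ⊛ β) ⊛ t) ⊕ (β ⊛ (β ⊛ c))
          ≡⟨ cong (λ u → ((β ⊛ β) ⊛ t) ⊕ (β ⊛ u)) β⊛c≡β-c ⟩
      ((β ⊛ β) ⊛ t) ⊕ (β ⊛ (β ⊝ c))
          ≡⟨ solveᴷ 3 (λ b c t → ((b *ᴷ b) *ᴷ t) +ᴷ (b *ᴷ (b -ᴷ c)) =ᴷ ((b *ᴷ b) *ᴷ t) +ᴷ ((b *ᴷ b) -ᴷ (b *ᴷ c))) refl β c t ⟩
      ((β ⊛ β) ⊛ t) ⊕ ((β ⊛ β) ⊝ (β ⊛ c))
          ≡⟨ cong₂ (λ u v → ((β ⊛ β) ⊛ t) ⊕ (u ⊝ v)) β²≡mβ-n β⊛c≡β-c ⟩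
      normal-form ∎

  digitAt-index : ∀ j d p {i} → (+ j ℤ.- + 1) ℤ.- p ≡ + i → digitAt j d p ≡ d i
  digitAt-index j d p eq rewrite eq = refl

  digitAt-cases : ∀ j d p → (Σ ℕ λ i → ((+ j ℤ.- + 1) ℤ.- p ≡ + i) × (digitAt j d p ≡ d i))
                          ⊎ (Σ ℕ λ k → ((+ j ℤ.- + 1) ℤ.- p ≡ -[1+ k ]) × (digitAt j d p ≡ + 0))
  digitAt-cases j d p with (+ j ℤ.- + 1) ℤ.- p
  ... | + i = inj₁ (i , refl , refl)
  ... | -[1+ k ] = inj₂ (k , refl , refl)

  digitAt-All : ∀ (P : ℤ → Set) j d → P (+ 0) → (∀ i → P (d i)) → ∀ p → P (digitAt j d p)
  digitAt-All P j d P0 Pd p with (+ j ℤ.- + 1) ℤ.- p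
  ... | + i = Pd i
  ... | -[1+ _ ] = P0

  digitAt-pred : ∀ j d p {i} → (+ j ℤ.- + 1) ℤ.- p ≡ + i → digitAt j d (p ℤ.- + 1) ≡ d (suc i)
  digitAt-pred j d p {i} eq = digitAt-index j d (p ℤ.- + 1) (begin
    (+ j ℤ.- + 1) ℤ.- (p ℤ.- + 1)   ≡⟨ shift (+ j ℤ.- + 1) p ⟩
    ((+ j ℤ.- + 1) ℤ.- p) ℤ.+ + 1   ≡⟨ cong (ℤ._+ + 1) eq ⟩
    + i ℤ.+ + 1                     ≡⟨ cong +_ (ℕP.+-comm i 1) ⟩
    + suc i                         ∎)
    where
    shift : ∀ a p → a ℤ.- (p ℤ.- + 1) ≡ (a ℤ.- p) ℤ.+ + 1
    shift = ℤ-Solver.solve-∀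

  <⇒+1≤ : ∀ {a b} → a ℤ.< b → a ℤ.+ + 1 ℤ.≤ b
  <⇒+1≤ {a} {b} h = subst (ℤ._≤ b) (ℤP.+-comm (+ 1) a) (ℤP.i<j⇒suc[i]≤j h)

  module Necessity (y₀ : K) (y₀∈I : OpenI y₀) (t : ℕ → K) (d : ℕ → ℤ) (t₀≈y₀ : t 0 ≈ y₀)
      (floor : ∀ i → IsFloor ((-βK ⊛ t i) ⊕ c) (d i)) (step : ∀ i → t (suc i) ≈ ((-βK ⊛ t i) ⊝ ι (d i))) where

    z : ℕ → K
    z i = (-βK ⊛ t i) ⊕ c

    t₀≡y₀ : t 0 ≡ y₀
    t₀≡y₀ = ≈⇒≡ {t 0} {y₀} t₀≈y₀

    step≡ : ∀ i → t (suc i) ≡ (-βK ⊛ t i) ⊝ ι (d i)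
    step≡ i = ≈⇒≡ {t (suc i)} {(-βK ⊛ t i) ⊝ ι (d i)} (step i)

    orbit-in-I : ∀ i → NonNeg (t i ⊝ l) × Pos (r ⊝ t i)
    orbit-in-I zero = inj₁ (Pos-≡ {y₀ ⊝ l} {t 0 ⊝ l} (proj₁ y₀∈I) (cong (_⊝ l) (sym t₀≡y₀))) ,
                      Pos-≡ {r ⊝ y₀} {r ⊝ t 0} (proj₂ y₀∈I) (cong (r ⊝_) (sym t₀≡y₀))
    orbit-in-I (suc i) = NonNeg-≡ {z i ⊝ ι (d i)} {t (suc i) ⊝ l} (≼⇒NonNeg {ι (d i)} {z i} (proj₁ (floor i))) left ,
                         Pos-≡ {ι (d i ℤ.+ + 1) ⊝ z i} {r ⊝ t (suc i)} (proj₂ (floor i)) right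
      where
      t′ = step≡ i
      left : z i ⊝ ι (d i) ≡ t (suc i) ⊝ l
      left = trans (solveᴷ 4 (λ b t c D → (((-ᴷ b) *ᴷ t) +ᴷ c) -ᴷ D =ᴷ (((-ᴷ b) *ᴷ t) -ᴷ D) -ᴷ (-ᴷ c)) refl β (t i) c (ι (d i)))
                 (cong (_⊝ l) (sym t′))
      right : ι (d i ℤ.+ + 1) ⊝ z i ≡ r ⊝ t (suc i)
      right = begin
        ι (d i ℤ.+ + 1) ⊝ z i         ≡⟨ cong (_⊝ z i) (ι-+ (d i) (+ 1)) ⟩
        (ι (d i) ⊕ 1K) ⊝ z i          ≡⟨ cong (λ u → (ι (d i) ⊕ u) ⊝ z i) (sym c⊕r≡1) ⟩
        (ι (d i) ⊕ (c ⊕ r)) ⊝ z i     ≡⟨ solveᴷ 5 (λ b t c r D → (D +ᴷ (c +ᴷ r)) -ᴷ (((-ᴷ b) *ᴷ t) +ᴷ c)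
                                           =ᴷ r -ᴷ (((-ᴷ b) *ᴷ t) -ᴷ D)) refl β (t i) c r (ι (d i)) ⟩
        r ⊝ ((-βK ⊛ t i) ⊝ ι (d i))   ≡⟨ cong (r ⊝_) (sym t′) ⟩
        r ⊝ t (suc i)                 ∎

    Pos-z : ∀ i → Pos (z i)
    Pos-z i = Pos-≡ {β ⊛ (r ⊝ t i)} {z i} (Pos-mul {β} {r ⊝ t i} Pos-β (proj₂ (orbit-in-I i)))
                (solveᴷ 3 (λ b r t → b *ᴷ (r -ᴷ t) =ᴷ ((-ᴷ b) *ᴷ t) +ᴷ (b *ᴷ r)) refl β r (t i))

    0≤digit : ∀ i → + 0 ℤ.≤ d i
    0≤digit i = decidable-stable (+ 0 ℤP.≤? d i) λ d<0 →
      ¬Pos-ι {d i ℤ.+ + 1} (<⇒+1≤ (ℤP.≰⇒> d<0))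
        (Pos-≡ {(ι (d i ℤ.+ + 1) ⊝ z i) ⊕ z i} {ι (d i ℤ.+ + 1)} (Pos-add {ι (d i ℤ.+ + 1) ⊝ z i} {z i} (proj₂ (floor i)) (Pos-z i))
        (solveᴷ 2 (λ a z → (a -ᴷ z) +ᴷ z =ᴷ a) refl (ι (d i ℤ.+ + 1)) (z i)))

    -- z i ≤ β because t i ≥ l, and β < m.
    digit<m : ∀ i → d i ℤ.< + m
    digit<m i = decidable-stable (d i ℤP.<? + m) λ m≤d →
      proj₁ (floor i) (Pos-≡ {(ι (+ m) ⊝ β) ⊕ ((ι (d i) ⊝ ι (+ m)) ⊕ (β ⊝ z i))} {ι (d i) ⊝ z i}
        (Pos-+-NonNeg {ι (+ m) ⊝ β} {(ι (d i) ⊝ ι (+ m)) ⊕ (β ⊝ z i)} β≺m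
          (NonNeg-+ {ι (d i) ⊝ ι (+ m)} {β ⊝ z i} (NonNeg-ι-⊝ {d i} {+ m} (ℤP.≮⇒≥ m≤d)) z≤β)) sum≡)
      where
      z≤β : NonNeg (β ⊝ z i)
      z≤β = NonNeg-≡ {β ⊛ (t i ⊝ l)} {β ⊝ z i} (Pos-*-NonNeg {β} {t i ⊝ l} Pos-β (proj₁ (orbit-in-I i))) (sym (β-[-βt+c]≡β[t-l] (t i)))
      sum≡ : (ι (+ m) ⊝ β) ⊕ ((ι (d i) ⊝ ι (+ m)) ⊕ (β ⊝ z i)) ≡ ι (d i) ⊝ z i
      sum≡ = solveᴷ 4 (λ M b D z → (M -ᴷ b) +ᴷ ((D -ᴷ M) +ᴷ (b -ᴷ z)) =ᴷ D -ᴷ z) refl (ι (+ m)) β (ι (d i)) (z i)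

    digit≡m-1⇒n≤next : ∀ i → d i ≡ + (m ∸ 1) → + n ℤ.≤ d (suc i)
    digit≡m-1⇒n≤next i dᵢ≡m-1 = decidable-stable (+ n ℤP.≤? d (suc i)) λ next<n →
      Pos∧NonNeg-⊖⇒⊥ {ι (d (suc i) ℤ.+ + 1) ⊝ z (suc i)} (proj₂ (floor (suc i)))
        (NonNeg-≡ {(z (suc i) ⊝ ι (+ n)) ⊕ (ι (+ n) ⊝ ι (d (suc i) ℤ.+ + 1))} {⊖ (ι (d (suc i) ℤ.+ + 1) ⊝ z (suc i))}
          (NonNeg-+ {z (suc i) ⊝ ι (+ n)} {ι (+ n) ⊝ ι (d (suc i) ℤ.+ + 1)} n≤z (NonNeg-ι-⊝ {+ n} {d (suc i) ℤ.+ + 1} (<⇒+1≤ (ℤP.≰⇒> next<n))))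
          (solveᴷ 3 (λ z N D → (z -ᴷ N) +ᴷ (N -ᴷ D) =ᴷ -ᴷ (D -ᴷ z)) refl (z (suc i)) (ι (+ n)) (ι (d (suc i) ℤ.+ + 1))))
      where
      t′ : t (suc i) ≡ (-βK ⊛ t i) ⊝ ι (+ (m ∸ 1))
      t′ = trans (step≡ i) (cong (λ u → (-βK ⊛ t i) ⊝ ι u) dᵢ≡m-1)
      n≤z : NonNeg (z (suc i) ⊝ ι (+ n))
      n≤z = NonNeg-≡ {β ⊛ (β ⊛ (t i ⊝ l))} {z (suc i) ⊝ ι (+ n)}
              (Pos-*-NonNeg {β} {β ⊛ (t i ⊝ l)} Pos-β (Pos-*-NonNeg {β} {t i ⊝ l} Pos-β (proj₁ (orbit-in-I i))))
             (trans (sym (-β[-βt-[m-1]]+c-n≡β²[t-l] (t i))) (cong (λ u → ((-βK ⊛ u) ⊕ c) ⊝ ι (+ n)) (sym t′)))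

  expansion-digits : ∀ {v x} → IsExpansion v x →
    (∀ i → (+ 0 ℤ.≤ x i) × (x i ℤ.< + m)) × (∀ i → x i ≡ + (m ∸ 1) → + n ℤ.≤ x (i ℤ.- + 1))
  expansion-digits {v} {x} (j , _ , y₀∈I , t , d , t₀≈y₀ , floor , step , x≡digitAt) = bounds , m-1⇒n≤next
    where
    open Necessity (v ⊛ pow (inv -βK) j) y₀∈I t d t₀≈y₀ floor step
    InRange : ℤ → Set
    InRange u = (+ 0 ℤ.≤ u) × (u ℤ.< + m)
    bounds : ∀ p → InRange (x p)
    bounds p = subst InRange (sym (x≡digitAt p))
                 (digitAt-All InRange j d (ℤ.+≤+ ℕ.z≤n , ℤ.+<+ 1≤m) (λ i → 0≤digit i , digit<m i) p)
    m-1⇒n≤next : ∀ p → x p ≡ + (m ∸ 1) → + n ℤ.≤ x (p ℤ.- + 1)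
    m-1⇒n≤next p xₚ≡m-1 = [ leading , trailing ]′ (digitAt-cases j d p)
      where
      leading : (Σ ℕ λ i → ((+ j ℤ.- + 1) ℤ.- p ≡ + i) × (digitAt j d p ≡ d i)) → + n ℤ.≤ x (p ℤ.- + 1)
      leading (i , index≡i , digit≡dᵢ) = subst (+ n ℤ.≤_) (sym (trans (x≡digitAt (p ℤ.- + 1)) (digitAt-pred j d p index≡i)))
        (digit≡m-1⇒n≤next i (trans (sym digit≡dᵢ) (trans (sym (x≡digitAt p)) xₚ≡m-1)))
      trailing : (Σ ℕ λ k → ((+ j ℤ.- + 1) ℤ.- p ≡ -[1+ k ]) × (digitAt j d p ≡ + 0)) → + n ℤ.≤ x (p ℤ.- + 1)
      trailing (_ , _ , digit≡0) = ⊥-elim (m∸1≢0 (ℤP.+-injective (trans (sym xₚ≡m-1) (trans (x≡digitAt p) digit≡0))))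
        where
        m∸1≢0 : m ∸ 1 ≢ 0
        m∸1≢0 = ℕP.>⇒≢ (ℕP.m<n⇒0<n∸m (ℕP.≤-trans (ℕP.m≤n+m 2 n) n+2≤m))

  γ-antitone : ∀ {u v} → Pos (u ⊝ (-βK ⊛ v)) → Pos (v ⊝ (γ ⊛ u))
  γ-antitone {u} {v} p = Pos-≡ {(⊖ γ) ⊛ (u ⊝ (-βK ⊛ v))} {v ⊝ (γ ⊛ u)} (Pos-mul {⊖ γ} {u ⊝ (-βK ⊛ v)} Pos-⊖γ p) (begin
    (⊖ γ) ⊛ (u ⊝ (-βK ⊛ v))    ≡⟨ solveᴷ 4 (λ g b u v → (-ᴷ g) *ᴷ (u -ᴷ ((-ᴷ b) *ᴷ v)) =ᴷ (g *ᴷ ((-ᴷ b) *ᴷ v)) -ᴷ (g *ᴷ u)) refl γ β u v ⟩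
    (γ ⊛ (-βK ⊛ v)) ⊝ (γ ⊛ u)  ≡⟨ cong (_⊝ (γ ⊛ u)) (γ-cancelˡ v) ⟩
    v ⊝ (γ ⊛ u)                ∎)

  γ-antitone′ : ∀ {u v} → Pos ((-βK ⊛ v) ⊝ u) → Pos ((γ ⊛ u) ⊝ v)
  γ-antitone′ {u} {v} p = Pos-≡ {(⊖ γ) ⊛ ((-βK ⊛ v) ⊝ u)} {(γ ⊛ u) ⊝ v} (Pos-mul {⊖ γ} {(-βK ⊛ v) ⊝ u} Pos-⊖γ p) (begin
    (⊖ γ) ⊛ ((-βK ⊛ v) ⊝ u)    ≡⟨ solveᴷ 4 (λ g b u v → (-ᴷ g) *ᴷ (((-ᴷ b) *ᴷ v) -ᴷ u) =ᴷ (g *ᴷ u) -ᴷ (g *ᴷ ((-ᴷ b) *ᴷ v))) refl γ β u v ⟩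
    (γ ⊛ u) ⊝ (γ ⊛ (-βK ⊛ v))  ≡⟨ cong ((γ ⊛ u) ⊝_) (γ-cancelˡ v) ⟩
    (γ ⊛ u) ⊝ v                ∎)

  -- Multiplication by -β maps (r, ∞) into (-∞, l) and (-∞, l) into (r, ∞), since β > 1.
  escapes-I : ∀ {u} → Pos (u ⊝ r) → ∀ e → Pos ((pow -βK e ⊛ u) ⊝ r) ⊎ Pos (l ⊝ (pow -βK e ⊛ u))
  escapes-I {u} r<u zero = inj₁ (Pos-≡ {u ⊝ r} {(1K ⊛ u) ⊝ r} r<u (cong (_⊝ r) (sym (⊛-idˡ u))))
  escapes-I {u} r<u (suc e) = [ r<w⇒ , w<l⇒ ]′ (escapes-I r<u e)
    where
    w = pow -βK e ⊛ u
    -β⊛w : pow -βK (suc e) ⊛ u ≡ -βK ⊛ w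
    -β⊛w = solveᴷ 3 (λ b p u → ((-ᴷ b) *ᴷ p) *ᴷ u =ᴷ (-ᴷ b) *ᴷ (p *ᴷ u)) refl β (pow -βK e) u
    r<w⇒ : Pos (w ⊝ r) → Pos ((pow -βK (suc e) ⊛ u) ⊝ r) ⊎ Pos (l ⊝ (pow -βK (suc e) ⊛ u))
    r<w⇒ r<w = inj₂ (Pos-≡ {β ⊛ (w ⊝ r)} {l ⊝ (pow -βK (suc e) ⊛ u)} (Pos-mul {β} {w ⊝ r} Pos-β r<w)
      (trans (solveᴷ 3 (λ b r w → b *ᴷ (w -ᴷ r) =ᴷ (-ᴷ (b *ᴷ r)) -ᴷ ((-ᴷ b) *ᴷ w)) refl β r w) (cong (l ⊝_) (sym -β⊛w))))
    w<l⇒ : Pos (l ⊝ w) → Pos ((pow -βK (suc e) ⊛ u) ⊝ r) ⊎ Pos (l ⊝ (pow -βK (suc e) ⊛ u))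
    w<l⇒ w<l = inj₁ (Pos-≡ {(β ⊛ (l ⊝ w)) ⊕ (β ⊝ 1K)} {(pow -βK (suc e) ⊛ u) ⊝ r}
      (Pos-add {β ⊛ (l ⊝ w)} {β ⊝ 1K} (Pos-mul {β} {l ⊝ w} Pos-β w<l) 1≺β)
      (trans (sym (-βw-r≡β[l-w]+β-1 w)) (cong (_⊝ r) (sym -β⊛w))))

  negβ^-suc : ∀ z → negβ^ (+ 1 ℤ.+ z) ≡ -βK ⊛ negβ^ z
  negβ^-suc (+ k) = refl
  negβ^-suc -[1+ zero ] = sym (trans (cong (-βK ⊛_) (⊛-idʳ γ)) -β⊛γ≡1)
  negβ^-suc -[1+ suc k ] = sym (γ-cancelʳ (pow γ (suc k)))

  module Sufficiency (x : ℤ → ℤ) (N : ℕ) (supp : SupportedIn x N)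
      (bounds : ∀ i → (+ 0 ℤ.≤ x i) × (x i ℤ.< + m))
      (cond : ∀ i → x i ≡ + (m ∸ 1) → + n ℤ.≤ x (i ℤ.- + 1)) where

    position : ℕ → ℤ
    position k = + k ℤ.- + N

    position-suc : ∀ k → position (suc k) ≡ + 1 ℤ.+ position k
    position-suc k = trans (cong (ℤ._- + N) (ℤP.pos-+ 1 k)) (e (+ k) (+ N))
      where
      e : ∀ a b → (+ 1 ℤ.+ a) ℤ.- b ≡ + 1 ℤ.+ (a ℤ.- b)
      e = ℤ-Solver.solve-∀

    position-pred : ∀ k → position (suc k) ℤ.- + 1 ≡ position k
    position-pred k = trans (cong (ℤ._- + 1) (position-suc k)) (e (position k))
      where
      e : ∀ a → (+ 1 ℤ.+ a) ℤ.- + 1 ≡ a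
      e = ℤ-Solver.solve-∀

    -- tail k is the number .x₍ₖ₋₁₋N₎ … x₍₋N₎ in base -β, that is Σ_{i<k} x₍ᵢ₋N₎ (-β)^(i-k).
    tail : ℕ → K
    tail zero = 0K
    tail (suc k) = γ ⊛ (ι (x (position k)) ⊕ tail k)

    -β⊛tail-suc : ∀ k → -βK ⊛ tail (suc k) ≡ ι (x (position k)) ⊕ tail k
    -β⊛tail-suc k = γ-cancelʳ (ι (x (position k)) ⊕ tail k)

    TailBounds : ℕ → Set
    TailBounds k = Pos (tail k ⊝ l) × Pos (r ⊝ tail k) × (+ n ℤ.≤ x (position k ℤ.- + 1) → Pos (B ⊝ tail k))

    shifted<-β⊛l : ∀ k → TailBounds k → Pos ((-βK ⊛ l) ⊝ (ι (x (position k)) ⊕ tail k))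
    shifted<-β⊛l k (_ , s<r , s<B) = [ digit≡m-1 , digit≢m-1 ]′ (toSum (a ℤ.≟ + (m ∸ 1)))
      where
      a = x (position k)
      s = tail k
      digit≡m-1 : a ≡ + (m ∸ 1) → Pos ((-βK ⊛ l) ⊝ (ι a ⊕ s))
      digit≡m-1 a≡m-1 = Pos-≡ {B ⊝ s} {(-βK ⊛ l) ⊝ (ι a ⊕ s)} (s<B (cond (position k) a≡m-1))
        (trans (solveᴷ 3 (λ u M s → (u -ᴷ M) -ᴷ s =ᴷ u -ᴷ (M +ᴷ s)) refl (-βK ⊛ l) (ι (+ (m ∸ 1))) s)
               (cong (λ a → (-βK ⊛ l) ⊝ (ι a ⊕ s)) (sym a≡m-1)))
      digit≢m-1 : a ≢ + (m ∸ 1) → Pos ((-βK ⊛ l) ⊝ (ι a ⊕ s))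
      digit≢m-1 a≢m-1 = Pos-≡ {(β ⊝ ι (+ (m ∸ 1))) ⊕ ((r ⊝ s) ⊕ (ι (+ m) ⊝ ι (a ℤ.+ + 1 ℤ.+ + 1)))} {(-βK ⊛ l) ⊝ (ι a ⊕ s)}
        (Pos-add {β ⊝ ι (+ (m ∸ 1))} {(r ⊝ s) ⊕ (ι (+ m) ⊝ ι (a ℤ.+ + 1 ℤ.+ + 1))} m∸1≺β
          (Pos-+-NonNeg {r ⊝ s} {ι (+ m) ⊝ ι (a ℤ.+ + 1 ℤ.+ + 1)} s<r (NonNeg-ι-⊝ {+ m} {a ℤ.+ + 1 ℤ.+ + 1} (<⇒+1≤ a+1<m)))) (begin
        (β ⊝ ι (+ (m ∸ 1))) ⊕ ((r ⊝ s) ⊕ (ι (+ m) ⊝ ι (a ℤ.+ + 1 ℤ.+ + 1)))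
          ≡⟨ cong₂ (λ u v → (β ⊝ u) ⊕ ((r ⊝ s) ⊕ (ι (+ m) ⊝ v))) ι[m∸1] (trans (ι-+ (a ℤ.+ + 1) (+ 1)) (cong (_⊕ 1K) (ι-+ a (+ 1)))) ⟩
        (β ⊝ (ι (+ m) ⊝ 1K)) ⊕ ((r ⊝ s) ⊕ (ι (+ m) ⊝ ((ι a ⊕ 1K) ⊕ 1K)))
          ≡⟨ solveᴷ 5 (λ b M r s A → (b -ᴷ (M -ᴷ conᴷ (+ 1))) +ᴷ ((r -ᴷ s) +ᴷ (M -ᴷ ((A +ᴷ conᴷ (+ 1)) +ᴷ conᴷ (+ 1))))
                 =ᴷ ((b +ᴷ r) -ᴷ conᴷ (+ 1)) -ᴷ (A +ᴷ s)) refl β (ι (+ m)) r s (ι a) ⟩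
        ((β ⊕ r) ⊝ 1K) ⊝ (ι a ⊕ s)
          ≡⟨ cong (_⊝ (ι a ⊕ s)) (sym -β⊛l≡β+r-1) ⟩
        (-βK ⊛ l) ⊝ (ι a ⊕ s)           ∎)
        where
        a+1<m : a ℤ.+ + 1 ℤ.< + m
        a+1<m = subst (ℤ._< + m) (ℤP.+-comm (+ 1) a) (ℤP.≤∧≢⇒< (ℤP.i<j⇒suc[i]≤j (proj₂ (bounds (position k)))) 1+a≢m)
          where
          e : ∀ a → a ≡ (+ 1 ℤ.+ a) ℤ.- + 1
          e = ℤ-Solver.solve-∀
          1+a≢m : + 1 ℤ.+ a ≢ + m
          1+a≢m 1+a≡m = a≢m-1 (begin
            a                    ≡⟨ e a ⟩
            (+ 1 ℤ.+ a) ℤ.- + 1  ≡⟨ cong (ℤ._- + 1) 1+a≡m ⟩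
            + m ℤ.- + 1          ≡⟨ trans (ℤP.m-n≡m⊖n m 1) (ℤP.⊖-≥ 1≤m) ⟩
            + (m ∸ 1)            ∎)

    tailBounds : ∀ k → TailBounds k
    tailBounds zero = Pos-≡ {c} {0K ⊝ l} Pos-c (solveᴷ 1 (λ c → c =ᴷ conᴷ (+ 0) -ᴷ (-ᴷ c)) refl c) ,
                      Pos-≡ {r} {r ⊝ 0K} Pos-r (sym (⊝-ι0 r)) ,
                      λ n≤x[-N-1] → ⊥-elim (ℕP.<-irrefl refl (ℕP.≤-trans 1≤n (ℤP.drop‿+≤+ (subst (+ n ℤ.≤_) x[-N-1]≡0 n≤x[-N-1]))))
      where
      x[-N-1]≡0 : x (position 0 ℤ.- + 1) ≡ + 0
      x[-N-1]≡0 = supp _ (subst (λ p → N ℕ.< ℤ.∣ p ∣) (sym -N-1≡-[1+N]) ℕP.≤-refl)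
        where
        e : ∀ a → (+ 0 ℤ.- a) ℤ.- + 1 ≡ ℤ.- (a ℤ.+ + 1)
        e = ℤ-Solver.solve-∀
        -N-1≡-[1+N] : position 0 ℤ.- + 1 ≡ -[1+ N ]
        -N-1≡-[1+N] = trans (e (+ N)) (cong (λ u → ℤ.- (+ u)) (ℕP.+-comm N 1))
    tailBounds (suc k) = l<tail-suc , tail-suc<r , tail-suc<B
      where
      s = tail k
      a = x (position k)
      l<s = proj₁ (tailBounds k)
      l<tail-suc : Pos (tail (suc k) ⊝ l)
      l<tail-suc = γ-antitone′ {ι a ⊕ s} {l} (shifted<-β⊛l k (tailBounds k))
      tail-suc<r : Pos (r ⊝ tail (suc k))
      tail-suc<r = γ-antitone {ι a ⊕ s} {r} (Pos-≡ {(s ⊝ l) ⊕ ι a} {(ι a ⊕ s) ⊝ (-βK ⊛ r)}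
        (Pos-+-NonNeg {s ⊝ l} {ι a} l<s (NonNeg-ι (proj₁ (bounds (position k)))))
        (solveᴷ 4 (λ b r s A → (s -ᴷ (-ᴷ (b *ᴷ r))) +ᴷ A =ᴷ (A +ᴷ s) -ᴷ ((-ᴷ b) *ᴷ r)) refl β r s (ι a)))
      tail-suc<B : + n ℤ.≤ x (position (suc k) ℤ.- + 1) → Pos (B ⊝ tail (suc k))
      tail-suc<B n≤x = γ-antitone {ι a ⊕ s} {B} (Pos-≡ {(s ⊝ l) ⊕ (ι a ⊝ ι (+ n))} {(ι a ⊕ s) ⊝ (-βK ⊛ B)}
        (Pos-+-NonNeg {s ⊝ l} {ι a ⊝ ι (+ n)} l<s (NonNeg-ι-⊝ {a} {+ n} (subst (λ p → + n ℤ.≤ x p) (position-pred k) n≤x)))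
        (trans (solveᴷ 4 (λ s l A N → (s -ᴷ l) +ᴷ (A -ᴷ N) =ᴷ (A +ᴷ s) -ᴷ (N +ᴷ l)) refl s l (ι a) (ι (+ n)))
               (cong ((ι a ⊕ s) ⊝_) (sym -β⊛B≡n+l))))

    open Leading x

    J : ℕ
    J = lead (suc N)

    x-vanishes-from-J : ∀ p → + J ℤ.≤ p → x p ≡ + 0
    x-vanishes-from-J p J≤p with p ℤP.<? + suc N
    ... | yes p≤N = lead-vanishes (suc N) p J≤p p≤N
    ... | no p≰N = supp p (N<∣p∣ (ℤP.≮⇒≥ p≰N))
      where
      N<∣p∣ : ∀ {p} → + suc N ℤ.≤ p → N ℕ.< ℤ.∣ p ∣
      N<∣p∣ (ℤ.+≤+ N<q) = N<q

    valueAux≡tail : ∀ k → valueAux x N k ≡ tail k ⊛ negβ^ (position k)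
    valueAux≡tail zero = sym (solveᴷ 1 (λ z → conᴷ (+ 0) *ᴷ z =ᴷ conᴷ (+ 0)) refl (negβ^ (position 0)))
    valueAux≡tail (suc k) = begin
      valueAux x N k ⊕ (a ⊛ negβ^ (position k))
        ≡⟨ cong (_⊕ (a ⊛ negβ^ (position k))) (valueAux≡tail k) ⟩
      (tail k ⊛ negβ^ (position k)) ⊕ (a ⊛ negβ^ (position k))
        ≡⟨ solveᴷ 3 (λ s z A → (s *ᴷ z) +ᴷ (A *ᴷ z) =ᴷ (A +ᴷ s) *ᴷ z) refl (tail k) (negβ^ (position k)) a ⟩
      (a ⊕ tail k) ⊛ negβ^ (position k)
        ≡⟨ cong (_⊛ negβ^ (position k)) (sym (-β⊛tail-suc k)) ⟩
      (-βK ⊛ tail (suc k)) ⊛ negβ^ (position k)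
        ≡⟨ solveᴷ 3 (λ b s z → ((-ᴷ b) *ᴷ s) *ᴷ z =ᴷ s *ᴷ ((-ᴷ b) *ᴷ z)) refl β (tail (suc k)) (negβ^ (position k)) ⟩
      tail (suc k) ⊛ (-βK ⊛ negβ^ (position k))
        ≡⟨ cong (tail (suc k) ⊛_) (sym (trans (cong negβ^ (position-suc k)) (negβ^-suc (position k)))) ⟩
      tail (suc k) ⊛ negβ^ (position (suc k)) ∎
      where
      a = ι (x (position k))

    tail-from-J : ∀ e → tail (e + (J + N)) ≡ pow γ e ⊛ tail (J + N)
    tail-from-J zero = sym (⊛-idˡ (tail (J + N)))
    tail-from-J (suc e) = begin
      γ ⊛ (ι (x (position (e + (J + N)))) ⊕ tail (e + (J + N)))
        ≡⟨ cong₂ (λ u v → γ ⊛ (ι u ⊕ v)) x≡0 (tail-from-J e) ⟩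
      γ ⊛ (ι (+ 0) ⊕ (pow γ e ⊛ tail (J + N)))
        ≡⟨ solveᴷ 3 (λ g p s → g *ᴷ (conᴷ (+ 0) +ᴷ (p *ᴷ s)) =ᴷ (g *ᴷ p) *ᴷ s) refl γ (pow γ e) (tail (J + N)) ⟩
      pow γ (suc e) ⊛ tail (J + N) ∎
      where
      e′ : ∀ a b → (a ℤ.+ b) ℤ.- b ≡ a
      e′ = ℤ-Solver.solve-∀
      position≡e+J : position (e + (J + N)) ≡ + (e + J)
      position≡e+J = trans (cong (λ u → + u ℤ.- + N) (sym (ℕP.+-assoc e J N)))
             (trans (cong (ℤ._- + N) (ℤP.pos-+ (e + J) N)) (e′ (+ (e + J)) (+ N)))
      x≡0 : x (position (e + (J + N))) ≡ + 0
      x≡0 = x-vanishes-from-J _ (subst (+ J ℤ.≤_) (sym position≡e+J) (ℤ.+≤+ (ℕP.m≤n+m J e)))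

    value≡[-β]^J⊛tail : value x N ≡ pow -βK J ⊛ tail (J + N)
    value≡[-β]^J⊛tail = begin
      valueAux x N (suc (N + N))
        ≡⟨ valueAux≡tail (suc (N + N)) ⟩
      tail (suc (N + N)) ⊛ negβ^ (position (suc (N + N)))
        ≡⟨ cong₂ _⊛_ (trans (cong tail (sym d+J+N≡1+2N)) (tail-from-J d)) (cong negβ^ top≡1+N) ⟩
      (pow γ d ⊛ tail (J + N)) ⊛ pow -βK (suc N)
        ≡⟨ cong ((pow γ d ⊛ tail (J + N)) ⊛_) (trans (cong (pow -βK) (sym d+J≡1+N)) (pow-+ -βK d J)) ⟩
      (pow γ d ⊛ tail (J + N)) ⊛ (pow -βK d ⊛ pow -βK J)
        ≡⟨ solveᴷ 4 (λ g s b q → (g *ᴷ s) *ᴷ (b *ᴷ q) =ᴷ ((b *ᴷ g) *ᴷ q) *ᴷ s) refl (pow γ d) (tail (J + N)) (pow -βK d) (pow -βK J) ⟩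
      ((pow -βK d ⊛ pow γ d) ⊛ pow -βK J) ⊛ tail (J + N)
        ≡⟨ cong (λ u → (u ⊛ pow -βK J) ⊛ tail (J + N)) (pow-cancel -β⊛γ≡1 d) ⟩
      (1K ⊛ pow -βK J) ⊛ tail (J + N)
        ≡⟨ cong (_⊛ tail (J + N)) (⊛-idˡ (pow -βK J)) ⟩
      pow -βK J ⊛ tail (J + N) ∎
      where
      d = suc N ∸ J
      d+J≡1+N : d + J ≡ suc N
      d+J≡1+N = ℕP.m∸n+n≡m (lead≤ (suc N))
      d+J+N≡1+2N : d + (J + N) ≡ suc (N + N)
      d+J+N≡1+2N = trans (sym (ℕP.+-assoc d J N)) (cong (_+ N) d+J≡1+N)
      e′ : ∀ a b → (a ℤ.+ b) ℤ.- b ≡ a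
      e′ = ℤ-Solver.solve-∀
      top≡1+N : position (suc (N + N)) ≡ + suc N
      top≡1+N = trans (cong (ℤ._- + N) (ℤP.pos-+ (suc N) N)) (e′ (+ suc N) (+ N))

    value⊛γ^j : ∀ e j → e + j ≡ J → value x N ⊛ pow γ j ≡ pow -βK e ⊛ tail (J + N)
    value⊛γ^j e j e+j≡J = begin
      value x N ⊛ pow γ j
        ≡⟨ cong (_⊛ pow γ j) (trans value≡[-β]^J⊛tail (cong (λ i → pow -βK i ⊛ tail (J + N)) (sym e+j≡J))) ⟩
      (pow -βK (e + j) ⊛ tail (J + N)) ⊛ pow γ j
        ≡⟨ cong (λ u → (u ⊛ tail (J + N)) ⊛ pow γ j) (pow-+ -βK e j) ⟩
      ((pow -βK e ⊛ pow -βK j) ⊛ tail (J + N)) ⊛ pow γ j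
        ≡⟨ solveᴷ 4 (λ p q s g → ((p *ᴷ q) *ᴷ s) *ᴷ g =ᴷ (p *ᴷ s) *ᴷ (q *ᴷ g)) refl (pow -βK e) (pow -βK j) (tail (J + N)) (pow γ j) ⟩
      (pow -βK e ⊛ tail (J + N)) ⊛ (pow -βK j ⊛ pow γ j)
        ≡⟨ cong ((pow -βK e ⊛ tail (J + N)) ⊛_) (pow-cancel -β⊛γ≡1 j) ⟩
      (pow -βK e ⊛ tail (J + N)) ⊛ 1K
        ≡⟨ ⊛-idʳ _ ⟩
      pow -βK e ⊛ tail (J + N) ∎

    value⊛γ^J : value x N ⊛ pow γ J ≡ tail (J + N)
    value⊛γ^J = trans (value⊛γ^j 0 J refl) (⊛-idˡ (tail (J + N)))

    -- The leading digit x₍J-1₎ is at least 1, so -β · tail (J + N) ≥ 1 + tail (J + N - 1) > 1 + l = r.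
    r<-β⊛tail : ∀ {j₀} → J ≡ suc j₀ → x (+ j₀) ≢ + 0 → Pos ((-βK ⊛ tail (J + N)) ⊝ r)
    r<-β⊛tail {j₀} J≡1+j₀ x₀≢0 = Pos-≡ {(tail k ⊝ l) ⊕ (ι (x (+ j₀)) ⊝ 1K)} {(-βK ⊛ tail (J + N)) ⊝ r}
        (Pos-+-NonNeg {tail k ⊝ l} {ι (x (+ j₀)) ⊝ 1K} (proj₁ (tailBounds k)) (NonNeg-ι-⊝ {x (+ j₀)} {+ 1} 1≤x₀)) (begin
      (tail k ⊝ l) ⊕ (ι (x (+ j₀)) ⊝ 1K)          ≡⟨ cong (λ z → (tail k ⊝ (⊖ z)) ⊕ (ι (x (+ j₀)) ⊝ 1K)) c≡1-r ⟩
      (tail k ⊝ (⊖ (1K ⊝ r))) ⊕ (ι (x (+ j₀)) ⊝ 1K)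
        ≡⟨ solveᴷ 3 (λ s r A → (s -ᴷ (-ᴷ (conᴷ (+ 1) -ᴷ r))) +ᴷ (A -ᴷ conᴷ (+ 1)) =ᴷ (A +ᴷ s) -ᴷ r) refl (tail k) r (ι (x (+ j₀))) ⟩
      (ι (x (+ j₀)) ⊕ tail k) ⊝ r                 ≡⟨ cong (_⊝ r) (sym -β⊛tail≡) ⟩
      (-βK ⊛ tail (J + N)) ⊝ r                    ∎)
      where
      k = j₀ + N
      e′ : ∀ a b → (a ℤ.+ b) ℤ.- b ≡ a
      e′ = ℤ-Solver.solve-∀
      position≡j₀ : position k ≡ + j₀
      position≡j₀ = trans (cong (ℤ._- + N) (ℤP.pos-+ j₀ N)) (e′ (+ j₀) (+ N))
      -β⊛tail≡ : -βK ⊛ tail (J + N) ≡ ι (x (+ j₀)) ⊕ tail k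
      -β⊛tail≡ = trans (cong (λ i → -βK ⊛ tail (i + N)) J≡1+j₀) (trans (-β⊛tail-suc k) (cong (λ p → ι (x p) ⊕ tail k) position≡j₀))
      1≤x₀ : + 1 ℤ.≤ x (+ j₀)
      1≤x₀ = ℤP.i<j⇒suc[i]≤j (ℤP.≤∧≢⇒< (proj₁ (bounds (+ j₀))) (λ 0≡x₀ → x₀≢0 (sym 0≡x₀)))

    not-in-I-below-J : ∀ j → j ℕ.< J → ¬ OpenI (value x N ⊛ pow γ j)
    not-in-I-below-J j j<J = [ J≡0⇒ , leading-digit⇒ ]′ (lead-nonzero (suc N))
      where
      y = value x N ⊛ pow γ j
      J≡0⇒ : J ≡ 0 → ¬ OpenI y
      J≡0⇒ J≡0 _ = ℕP.<-irrefl (sym J≡0) (ℕP.≤-<-trans ℕ.z≤n j<J)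
      leading-digit⇒ : (Σ ℕ λ j₀ → (J ≡ suc j₀) × (x (+ j₀) ≢ + 0)) → ¬ OpenI y
      leading-digit⇒ (j₀ , J≡1+j₀ , x₀≢0) (l<y , y<r) = [ r<y⇒⊥ , y<l⇒⊥ ]′ (escapes-I {u} (r<-β⊛tail J≡1+j₀ x₀≢0) e)
        where
        u = -βK ⊛ tail (J + N)
        e = j₀ ∸ j
        1+e+j≡J : suc e + j ≡ J
        1+e+j≡J = trans (cong suc (ℕP.m∸n+n≡m (ℕP.≤-pred (subst (suc j ≤_) J≡1+j₀ j<J)))) (sym J≡1+j₀)
        y≡ : y ≡ pow -βK e ⊛ u
        y≡ = trans (value⊛γ^j (suc e) j 1+e+j≡J)
               (solveᴷ 3 (λ b p s → ((-ᴷ b) *ᴷ p) *ᴷ s =ᴷ p *ᴷ ((-ᴷ b) *ᴷ s)) refl β (pow -βK e) (tail (J + N)))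
        r<y⇒⊥ : Pos ((pow -βK e ⊛ u) ⊝ r) → ⊥
        r<y⇒⊥ p = Pos-asym {r ⊝ y} y<r (Pos-≡ {(pow -βK e ⊛ u) ⊝ r} {⊖ (r ⊝ y)} p (trans (cong (_⊝ r) (sym y≡)) (sym (⊖-⊝ y r))))
        y<l⇒⊥ : Pos (l ⊝ (pow -βK e ⊛ u)) → ⊥
        y<l⇒⊥ p = Pos-asym {y ⊝ l} l<y (Pos-≡ {l ⊝ (pow -βK e ⊛ u)} {⊖ (y ⊝ l)} p (trans (cong (l ⊝_) (sym y≡)) (sym (⊖-⊝ l y))))

    orbit : ℕ → K
    orbit i = tail (J + N ∸ i)

    digits : ℕ → ℤ
    digits i = x ((+ J ℤ.- + 1) ℤ.- + i)

    position[J+N∸1+i] : ∀ {i} → i ℕ.< J + N → position (J + N ∸ suc i) ≡ (+ J ℤ.- + 1) ℤ.- + i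
    position[J+N∸1+i] {i} i<J+N = begin
      + q ℤ.- + N                                   ≡⟨ cong (ℤ._- + N) (e₁ (+ q) (+ suc i)) ⟩
      ((+ q ℤ.+ + suc i) ℤ.- + suc i) ℤ.- + N       ≡⟨ cong (λ z → (z ℤ.- + suc i) ℤ.- + N)
                                                         (trans (cong +_ (ℕP.m∸n+n≡m i<J+N)) (ℤP.pos-+ J N)) ⟩
      ((+ J ℤ.+ + N) ℤ.- + suc i) ℤ.- + N           ≡⟨ cong (λ z → ((+ J ℤ.+ + N) ℤ.- z) ℤ.- + N) (ℤP.pos-+ 1 i) ⟩
      ((+ J ℤ.+ + N) ℤ.- (+ 1 ℤ.+ + i)) ℤ.- + N     ≡⟨ e₂ (+ J) (+ N) (+ i) ⟩
      (+ J ℤ.- + 1) ℤ.- + i                         ∎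
      where
      q = J + N ∸ suc i
      e₁ : ∀ a b → a ≡ (a ℤ.+ b) ℤ.- b
      e₁ = ℤ-Solver.solve-∀
      e₂ : ∀ a b c → ((a ℤ.+ b) ℤ.- (+ 1 ℤ.+ c)) ℤ.- b ≡ (a ℤ.- + 1) ℤ.- c
      e₂ = ℤ-Solver.solve-∀

    digits-beyond : ∀ {i} → J + N ≤ i → digits i ≡ + 0
    digits-beyond {i} J+N≤i = supp _ (subst (λ p → N ℕ.< ℤ.∣ p ∣) (sym index≡) (ℕ.s≤s (ℕP.m≤m+n N f)))
      where
      f = i ∸ (J + N)
      e : ∀ a b → (a ℤ.- + 1) ℤ.- (a ℤ.+ b) ≡ ℤ.- (+ 1 ℤ.+ b)
      e = ℤ-Solver.solve-∀
      index≡ : (+ J ℤ.- + 1) ℤ.- + i ≡ -[1+ (N + f) ]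
      index≡ = begin
        (+ J ℤ.- + 1) ℤ.- + i                  ≡⟨ cong (λ k → (+ J ℤ.- + 1) ℤ.- + k) (trans (sym (ℕP.m+[n∸m]≡n J+N≤i)) (ℕP.+-assoc J N f)) ⟩
        (+ J ℤ.- + 1) ℤ.- + (J + (N + f))      ≡⟨ cong (λ q → (+ J ℤ.- + 1) ℤ.- q) (ℤP.pos-+ J (N + f)) ⟩
        (+ J ℤ.- + 1) ℤ.- (+ J ℤ.+ + (N + f))  ≡⟨ e (+ J) (+ (N + f)) ⟩
        ℤ.- (+ 1 ℤ.+ + (N + f))                ∎

    orbit-step : ∀ i → orbit (suc i) ≡ (-βK ⊛ orbit i) ⊝ ι (digits i)
    orbit-step i = [ inside , outside ]′ (toSum (i ℕP.<? J + N))
      where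
      inside : i ℕ.< J + N → orbit (suc i) ≡ (-βK ⊛ orbit i) ⊝ ι (digits i)
      inside i<J+N = begin
        tail q                                       ≡⟨ solveᴷ 2 (λ s D → s =ᴷ (D +ᴷ s) -ᴷ D) refl (tail q) (ι (digits i)) ⟩
        (ι (digits i) ⊕ tail q) ⊝ ι (digits i)       ≡⟨ cong (λ p → (ι (x p) ⊕ tail q) ⊝ ι (digits i)) (sym (position[J+N∸1+i] i<J+N)) ⟩
        (ι (x (position q)) ⊕ tail q) ⊝ ι (digits i) ≡⟨ cong (_⊝ ι (digits i)) (sym (-β⊛tail-suc q)) ⟩
        (-βK ⊛ tail (suc q)) ⊝ ι (digits i)          ≡⟨ cong (λ k → (-βK ⊛ tail k) ⊝ ι (digits i)) (sym (m∸n≡1+[m∸1+n] i<J+N)) ⟩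
        (-βK ⊛ orbit i) ⊝ ι (digits i)               ∎
        where
        q = J + N ∸ suc i
      outside : ¬ i ℕ.< J + N → orbit (suc i) ≡ (-βK ⊛ orbit i) ⊝ ι (digits i)
      outside i≮J+N = begin
        tail (J + N ∸ suc i)              ≡⟨ cong tail (ℕP.m≤n⇒m∸n≡0 (ℕP.m≤n⇒m≤1+n J+N≤i)) ⟩
        0K                                ≡⟨ solveᴷ 1 (λ b → conᴷ (+ 0) =ᴷ ((-ᴷ b) *ᴷ conᴷ (+ 0)) -ᴷ conᴷ (+ 0)) refl β ⟩
        (-βK ⊛ 0K) ⊝ ι (+ 0)              ≡⟨ cong₂ (λ k d → (-βK ⊛ tail k) ⊝ ι d) (sym (ℕP.m≤n⇒m∸n≡0 J+N≤i)) (sym (digits-beyond J+N≤i)) ⟩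
        (-βK ⊛ orbit i) ⊝ ι (digits i)    ∎
        where
        J+N≤i = ℕP.≮⇒≥ i≮J+N

    floors : ∀ i → IsFloor ((-βK ⊛ orbit i) ⊕ c) (digits i)
    floors i = d≼z , z<d+1
      where
      t′ = orbit (suc i)
      D = ι (digits i)
      z = (-βK ⊛ orbit i) ⊕ c
      l<t′ = proj₁ (tailBounds (J + N ∸ suc i))
      t′<r = proj₁ (proj₂ (tailBounds (J + N ∸ suc i)))
      -β⊛orbit≡ : -βK ⊛ orbit i ≡ D ⊕ t′
      -β⊛orbit≡ = trans (solveᴷ 2 (λ X D → X =ᴷ D +ᴷ (X -ᴷ D)) refl (-βK ⊛ orbit i) D) (cong (D ⊕_) (sym (orbit-step i)))
      d≼z : ¬ Pos (D ⊝ z)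
      d≼z p = Pos-asym {t′ ⊝ l} l<t′ (Pos-≡ {D ⊝ z} {⊖ (t′ ⊝ l)} p (trans (cong (λ u → D ⊝ (u ⊕ c)) -β⊛orbit≡)
                 (solveᴷ 3 (λ D t c → D -ᴷ ((D +ᴷ t) +ᴷ c) =ᴷ -ᴷ (t -ᴷ (-ᴷ c))) refl D t′ c)))
      z<d+1 : Pos (ι (digits i ℤ.+ + 1) ⊝ z)
      z<d+1 = Pos-≡ {r ⊝ t′} {ι (digits i ℤ.+ + 1) ⊝ z} t′<r (sym (begin
        ι (digits i ℤ.+ + 1) ⊝ z            ≡⟨ cong₂ (λ u v → u ⊝ (v ⊕ c)) (ι-+ (digits i) (+ 1)) -β⊛orbit≡ ⟩
        (D ⊕ 1K) ⊝ ((D ⊕ t′) ⊕ c)           ≡⟨ cong (λ u → (D ⊕ 1K) ⊝ ((D ⊕ t′) ⊕ u)) c≡1-r ⟩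
        (D ⊕ 1K) ⊝ ((D ⊕ t′) ⊕ (1K ⊝ r))    ≡⟨ solveᴷ 3 (λ D t r → (D +ᴷ conᴷ (+ 1)) -ᴷ ((D +ᴷ t) +ᴷ (conᴷ (+ 1) -ᴷ r)) =ᴷ r -ᴷ t) refl D t′ r ⟩
        r ⊝ t′                              ∎))

    digits-agree : ∀ p → x p ≡ digitAt J digits p
    digits-agree p = [ inside , beyond ]′ (digitAt-cases J digits p)
      where
      e₁ : ∀ a p → p ≡ a ℤ.- (a ℤ.- p)
      e₁ = ℤ-Solver.solve-∀
      e₂ : ∀ a b → (a ℤ.- + 1) ℤ.- (ℤ.- (+ 1 ℤ.+ b)) ≡ a ℤ.+ b
      e₂ = ℤ-Solver.solve-∀
      inside : (Σ ℕ λ i → ((+ J ℤ.- + 1) ℤ.- p ≡ + i) × (digitAt J digits p ≡ digits i)) → x p ≡ digitAt J digits p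
      inside (i , index≡i , digit≡) = trans (cong x (trans (e₁ (+ J ℤ.- + 1) p) (cong (λ q → (+ J ℤ.- + 1) ℤ.- q) index≡i))) (sym digit≡)
      beyond : (Σ ℕ λ k → ((+ J ℤ.- + 1) ℤ.- p ≡ -[1+ k ]) × (digitAt J digits p ≡ + 0)) → x p ≡ digitAt J digits p
      beyond (k , index≡ , digit≡0) = trans (x-vanishes-from-J p (subst (+ J ℤ.≤_) (sym p≡J+k) (ℤ.+≤+ (ℕP.m≤m+n J k)))) (sym digit≡0)
        where
        p≡J+k : p ≡ + (J + k)
        p≡J+k = trans (e₁ (+ J ℤ.- + 1) p) (trans (cong (λ q → (+ J ℤ.- + 1) ℤ.- q) index≡) (trans (e₂ (+ J) (+ k)) (sym (ℤP.pos-+ J k))))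

    expansion : IsExpansion (value x N) x
    expansion = J , not-in-I-below-J ,
      (Pos-≡ {tail (J + N) ⊝ l} {(value x N ⊛ pow γ J) ⊝ l} l<tail (cong (_⊝ l) (sym value⊛γ^J)) ,
       Pos-≡ {r ⊝ tail (J + N)} {r ⊝ (value x N ⊛ pow γ J)} tail<r (cong (r ⊝_) (sym value⊛γ^J))) ,
      orbit , digits , ≡⇒≈ {tail (J + N)} {value x N ⊛ pow γ J} (sym value⊛γ^J) , floors ,
      (λ i → ≡⇒≈ {orbit (suc i)} {(-βK ⊛ orbit i) ⊝ ι (digits i)} (orbit-step i)) , digits-agree
      where
      l<tail = proj₁ (tailBounds (J + N))
      tail<r = proj₁ (proj₂ (tailBounds (J + N)))

lemma10 : (m n : ℕ) → 1 ≤ n → n + 2 ≤ m →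
    (x : ℤ → ℤ) → (N : ℕ) → SupportedIn x N →
    Admissible m n x N ⇔
    ((∀ i → (+ 0 ℤ.≤ x i) × (x i ℤ.< + m)) ×
    (∀ i → x i ≡ + (m ∸ 1) → + n ℤ.≤ x (i ℤ.- + 1)))
lemma10 m n 1≤n n+2≤m x N supp =
  mk⇔ (expansion-digits {value x N} {x}) (λ (bounds , cond) → Sufficiency.expansion x N supp bounds cond)
  where open Expansion m n 1≤n n+2≤m
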